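{- Let $X$ be a graph, let $X^{\square 2}=X\square X$ with diagonal $D=\{(i,i):i\in V(X)\}$, and let $Y$ be the quotient of $X^{\square 2}$ by the orbit partition of the flip $(i,j)\mapsto(j,i)$ (cells: singletons $\{(i,i)\}$ and pairs $\{(i,j),(j,i)\}$, $i\neq j$), with quotient matrix $B$. Let $D$ also denote the set of singleton diagonal cells in $Y$, and let $\phi(Y,t)=\det(tI-B)$ and $\phi(Y\setminus D,t)$ the characteristic polynomial of the principal submatrix of $B$ indexed by the non-diagonal cells. Then \[ \frac{\phi(Y\setminus D,t)}{\phi(Y,t)}=\frac{\phi(X^{\square 2}\setminus D,t)}{\phi(X^{\square 2},t)}. \]
   Context: The Cartesian product $X\square X$ has vertex set $V(X)\times V(X)$ and adjacency matrix $A\otimes I+I\otimes A$. The flip orbit partition is equitable: for cells $C_i,C_j$ each vertex of $C_i$ has the same number $b_{ij}$ of neighbours in $C_j$, and the quotient matrix is $B=(b_{ij})$. $\phi(Z,t)$ denotes the characteristic polynomial of the adjacency matrix of $Z$, and $Z\setminus S$ the subgraph induced on $V(Z)\setminus S$. -}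

module Defs where

open import Data.Bool using (Bool; true; false; if_then_else_)
open import Data.Nat using (ℕ; zero; suc)
open import Data.Integer using (ℤ; 0ℤ; 1ℤ) renaming (_+_ to _+ℤ_; _*_ to _*ℤ_; -_ to -ℤ_)
open import Data.Fin using (Fin; _≟_; _<?_; _≤?_)
open import Data.Fin.Base using (_<_)
open import Data.List using (List; []; _∷_; map; filter; concatMap; allFin; _++_; foldr)
open import Data.Product using (_×_; _,_; proj₁; proj₂)
open import Relation.Nullary using (¬_; ¬?; does)
open import Relation.Binary.PropositionalEquality using (_≡_)
open import Relation.Binary.Definitions using (DecidableEquality)

-- Polynomials over ℤ as coefficient lists (lowest degree first).
-- Two polynomials are equal iff all coefficients agree (trailing zeros
-- are irrelevant).

Poly : Set
Poly = List ℤ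

coeff : Poly → ℕ → ℤ
coeff []      _       = 0ℤ
coeff (a ∷ p) zero    = a
coeff (a ∷ p) (suc k) = coeff p k

_≈ₚ_ : Poly → Poly → Set
p ≈ₚ q = ∀ k → coeff p k ≡ coeff q k

constₚ : ℤ → Poly
constₚ a = a ∷ []

0ₚ 1ₚ tₚ : Poly
0ₚ = []
1ₚ = constₚ 1ℤ
tₚ = 0ℤ ∷ 1ℤ ∷ []

_+ₚ_ : Poly → Poly → Poly
[]      +ₚ q       = q
(a ∷ p) +ₚ []      = a ∷ p
(a ∷ p) +ₚ (b ∷ q) = (a +ℤ b) ∷ (p +ₚ q)

-ₚ_ : Poly → Poly
-ₚ p = map -ℤ_ p

_-ₚ_ : Poly → Poly → Poly
p -ₚ q = p +ₚ (-ₚ q)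

_*ₚ_ : Poly → Poly → Poly
[]      *ₚ q = []
(a ∷ p) *ₚ q = map (a *ℤ_) q +ₚ (0ℤ ∷ (p *ₚ q))

infixl 6 _+ₚ_ _-ₚ_
infixl 7 _*ₚ_
infix 4 _≈ₚ_

-- Determinant of the square submatrix of a Poly-valued matrix M with
-- rows indexed (in order) by a list rs and columns by a list cs, defined
-- by Laplace (cofactor) expansion along the first row.

module _ {V : Set} (M : V → V → Poly) where

  -- expand r d before after s : Σ over columns c in `after`
  -- of (±) M r c * d (before ++ rest), sign alternating, starting with s.
  expand : V → (List V → Poly) → List V → List V → Bool → Poly
  expand r d before []          s = 0ₚ
  expand r d before (c ∷ after) s =
    (if s then term else -ₚ term) +ₚ expand r d (before ++ (c ∷ [])) after (if s then false else true)
    where term = M r c *ₚ d (before ++ after)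

  detSub : List V → List V → Poly
  detSub []       []      = 1ₚ
  detSub []       (_ ∷ _) = 0ₚ
  detSub (r ∷ rs) cs      = expand r (detSub rs) [] cs true

  det : List V → Poly
  det I = detSub I I

charMat : {V : Set} → DecidableEquality V → (V → V → ℤ) → V → V → Poly
charMat _≟V_ A u v = (if does (u ≟V v) then tₚ else 0ₚ) -ₚ constₚ (A u v)

charPoly : {V : Set} → DecidableEquality V → (V → V → ℤ) → List V → Poly
charPoly eq A I = det (charMat eq A) I

record Graph (n : ℕ) : Set where
  field
    adj   : Fin n → Fin n → Bool
    sym   : ∀ i j → adj i j ≡ adj j i
    irrefl : ∀ i → adj i i ≡ false

open Graph public

[_] : Bool → ℤ
[ true ]  = 1ℤ
[ false ] = 0ℤ

adjMat : ∀ {n} → Graph n → Fin n → Fin n → ℤ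
adjMat X i j = [ adj X i j ]

Pair : ℕ → Set
Pair n = Fin n × Fin n

pairEq : ∀ {n} → DecidableEquality (Pair n)
pairEq (i , j) (k , l) with i ≟ k | j ≟ l
... | Relation.Nullary.yes Relation.Binary.PropositionalEquality.refl | Relation.Nullary.yes Relation.Binary.PropositionalEquality.refl = Relation.Nullary.yes Relation.Binary.PropositionalEquality.refl
... | Relation.Nullary.no ¬p | _ = Relation.Nullary.no λ { Relation.Binary.PropositionalEquality.refl → ¬p Relation.Binary.PropositionalEquality.refl }
... | Relation.Nullary.yes _ | Relation.Nullary.no ¬q = Relation.Nullary.no λ { Relation.Binary.PropositionalEquality.refl → ¬q Relation.Binary.PropositionalEquality.refl }

-- adjacency matrix of X □ X :  A ⊗ I + I ⊗ A
boxAdj : ∀ {n} → Graph n → Pair n → Pair n → ℤ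
boxAdj X (i , j) (k , l) =
  ([ does (i ≟ k) ] *ℤ adjMat X j l) +ℤ (adjMat X i k *ℤ [ does (j ≟ l) ])

allPairs : (n : ℕ) → List (Pair n)
allPairs n = concatMap (λ i → map (i ,_) (allFin n)) (allFin n)

offDiagPairs : (n : ℕ) → List (Pair n)
offDiagPairs n = filter (λ p → ¬? (proj₁ p ≟ proj₂ p)) (allPairs n)

-- cells of the flip orbit partition, represented by (i , j) with i ≤ j
cells : (n : ℕ) → List (Pair n)
cells n = filter (λ p → proj₁ p ≤? proj₂ p) (allPairs n)

-- non-diagonal cells {(i,j),(j,i)}, i < j
offDiagCells : (n : ℕ) → List (Pair n)
offDiagCells n = filter (λ p → proj₁ p <? proj₂ p) (allPairs n)

cellElems : ∀ {n} → Pair n → List (Pair n)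
cellElems (k , l) = if does (k ≟ l) then (k , l) ∷ [] else (k , l) ∷ (l , k) ∷ []

sumℤ : List ℤ → ℤ
sumℤ = foldr _+ℤ_ 0ℤ

-- quotient matrix B: b_{c c'} = number of neighbours in cell c' of the
-- representative (i , j) of cell c (well defined as the partition is equitable)
quotMat : ∀ {n} → Graph n → Pair n → Pair n → ℤ
quotMat X c c' = sumℤ (map (boxAdj X c) (cellElems c'))

module Submission where

-- List the vertices of X □ X as the cell representatives (i , j), i ≤ j, followed by the
-- pairs with i > j.  Adding column (j , i) to column (i , j) for i < j and then subtracting
-- row (j , i) from row (i , j) for i > j leaves det (tI − A) unchanged.  Since A is invariant
-- under the flip, the result is block triangular: its block on the cells is tI − B, and the
-- rows with i > j vanish on the cell columns.  The other diagonal block M only involves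
-- vertices outside D, so the same operations on X □ X ∖ D give φ(X □ X) = φ(Y) · det M and
-- φ(X □ X ∖ D) = φ(Y ∖ D) · det M, which is the claim cross-multiplied.

open import Defs hiding (sym)
open import Data.Nat using (ℕ)
open import Algebra.Bundles using (Ring; CommutativeRing)

module PolynomialRing where

  open import Data.Nat using (zero; suc)
  open import Data.Integer using (ℤ; 0ℤ; 1ℤ) renaming (_+_ to _+ℤ_; _*_ to _*ℤ_; -_ to -ℤ_)
  import Data.Integer.Properties as ℤ
  open import Data.Integer.Tactic.RingSolver using (solve-∀)
  open import Data.List using ([]; _∷_; map)
  open import Data.Product using (_,_)
  open import Level using (0ℓ)
  import Algebra.Properties.CommutativeSemigroup as CommutativeSemigroupProperties
  open import Relation.Binary.PropositionalEquality using (_≡_; refl; sym; trans; cong; cong₂; module ≡-Reasoning)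

  coeff-+ : ∀ p q k → coeff (p +ₚ q) k ≡ coeff p k +ℤ coeff q k
  coeff-+ []      q       k       = sym (ℤ.+-identityˡ _)
  coeff-+ (a ∷ p) []      k       = sym (ℤ.+-identityʳ _)
  coeff-+ (a ∷ p) (b ∷ q) zero    = refl
  coeff-+ (a ∷ p) (b ∷ q) (suc k) = coeff-+ p q k

  coeff-map : ∀ (f : ℤ → ℤ) → f 0ℤ ≡ 0ℤ → ∀ p k → coeff (map f p) k ≡ f (coeff p k)
  coeff-map f f0≡0 []      k       = sym f0≡0
  coeff-map f f0≡0 (a ∷ p) zero    = refl
  coeff-map f f0≡0 (a ∷ p) (suc k) = coeff-map f f0≡0 p k

  coeff-neg : ∀ p k → coeff (-ₚ p) k ≡ -ℤ coeff p k
  coeff-neg = coeff-map -ℤ_ refl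

  coeff-scale : ∀ a p k → coeff (map (a *ℤ_) p) k ≡ a *ℤ coeff p k
  coeff-scale a = coeff-map (a *ℤ_) (ℤ.*-zeroʳ a)

  coeff-*-∷ : ∀ a p q k → coeff ((a ∷ p) *ₚ q) k ≡ a *ℤ coeff q k +ℤ coeff (0ℤ ∷ p *ₚ q) k
  coeff-*-∷ a p q k = trans (coeff-+ (map (a *ℤ_) q) (0ℤ ∷ p *ₚ q) k) (cong (_+ℤ coeff (0ℤ ∷ p *ₚ q) k) (coeff-scale a q k))

  ≈ₚ-refl : ∀ {p} → p ≈ₚ p
  ≈ₚ-refl k = refl

  ≈ₚ-sym : ∀ {p q} → p ≈ₚ q → q ≈ₚ p
  ≈ₚ-sym p≈q k = sym (p≈q k)

  ≈ₚ-trans : ∀ {p q r} → p ≈ₚ q → q ≈ₚ r → p ≈ₚ r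
  ≈ₚ-trans p≈q q≈r k = trans (p≈q k) (q≈r k)

  ∷-cong : ∀ {a b p q} → a ≡ b → p ≈ₚ q → a ∷ p ≈ₚ b ∷ q
  ∷-cong a≡b p≈q zero    = a≡b
  ∷-cong a≡b p≈q (suc k) = p≈q k

  +-cong : ∀ {p p′ q q′} → p ≈ₚ p′ → q ≈ₚ q′ → p +ₚ q ≈ₚ p′ +ₚ q′
  +-cong {p} {p′} {q} {q′} p≈p′ q≈q′ k =
    trans (coeff-+ p q k) (trans (cong₂ _+ℤ_ (p≈p′ k) (q≈q′ k)) (sym (coeff-+ p′ q′ k)))

  -‿cong : ∀ {p q} → p ≈ₚ q → -ₚ p ≈ₚ -ₚ q
  -‿cong {p} {q} p≈q k = trans (coeff-neg p k) (trans (cong -ℤ_ (p≈q k)) (sym (coeff-neg q k)))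

  +-assoc : ∀ p q r → (p +ₚ q) +ₚ r ≈ₚ p +ₚ (q +ₚ r)
  +-assoc p q r k = begin
    coeff ((p +ₚ q) +ₚ r) k               ≡⟨ trans (coeff-+ (p +ₚ q) r k) (cong (_+ℤ coeff r k) (coeff-+ p q k)) ⟩
    coeff p k +ℤ coeff q k +ℤ coeff r k   ≡⟨ ℤ.+-assoc (coeff p k) _ _ ⟩
    coeff p k +ℤ (coeff q k +ℤ coeff r k) ≡⟨ sym (trans (coeff-+ p (q +ₚ r) k) (cong (coeff p k +ℤ_) (coeff-+ q r k))) ⟩
    coeff (p +ₚ (q +ₚ r)) k               ∎
    where open ≡-Reasoning

  +-comm : ∀ p q → p +ₚ q ≈ₚ q +ₚ p
  +-comm p q k = trans (coeff-+ p q k) (trans (ℤ.+-comm (coeff p k) (coeff q k)) (sym (coeff-+ q p k)))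

  +-identityˡ : ∀ p → 0ₚ +ₚ p ≈ₚ p
  +-identityˡ p k = refl

  +-identityʳ : ∀ p → p +ₚ 0ₚ ≈ₚ p
  +-identityʳ p k = trans (coeff-+ p [] k) (ℤ.+-identityʳ _)

  -‿inverseˡ : ∀ p → (-ₚ p) +ₚ p ≈ₚ 0ₚ
  -‿inverseˡ p k = trans (coeff-+ (-ₚ p) p k) (trans (cong (_+ℤ coeff p k) (coeff-neg p k)) (ℤ.+-inverseˡ (coeff p k)))

  -‿inverseʳ : ∀ p → p +ₚ (-ₚ p) ≈ₚ 0ₚ
  -‿inverseʳ p = ≈ₚ-trans {p +ₚ (-ₚ p)} {(-ₚ p) +ₚ p} {[]} (+-comm p (-ₚ p)) (-‿inverseˡ p)

  *-zeroˡ : ∀ p q → p ≈ₚ 0ₚ → p *ₚ q ≈ₚ 0ₚ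
  *-zeroˡ []      q p≈0 k = refl
  *-zeroˡ (a ∷ p) q p≈0 k = trans (coeff-*-∷ a p q k) (coeff≡0 k)
    where
    coeff≡0 : ∀ k → a *ℤ coeff q k +ℤ coeff (0ℤ ∷ p *ₚ q) k ≡ 0ℤ
    coeff≡0 zero    rewrite p≈0 zero = refl
    coeff≡0 (suc k) rewrite p≈0 zero | *-zeroˡ p q (λ j → p≈0 (suc j)) k = refl

  *-zeroʳ : ∀ p → p *ₚ 0ₚ ≈ₚ 0ₚ
  *-zeroʳ []      k       = refl
  *-zeroʳ (a ∷ p) zero    = refl
  *-zeroʳ (a ∷ p) (suc k) = *-zeroʳ p k

  *-congʳ : ∀ p p′ q → p ≈ₚ p′ → p *ₚ q ≈ₚ p′ *ₚ q
  *-congʳ []      p′       q p≈p′ = ≈ₚ-sym {p′ *ₚ q} {[]} (*-zeroˡ p′ q (≈ₚ-sym {[]} {p′} p≈p′))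
  *-congʳ (a ∷ p) []       q p≈p′ = *-zeroˡ (a ∷ p) q p≈p′
  *-congʳ (a ∷ p) (b ∷ p′) q p≈p′ =
    +-cong {map (a *ℤ_) q} {map (b *ℤ_) q} (λ k → cong (λ x → coeff (map (x *ℤ_) q) k) (p≈p′ zero))
           (∷-cong {p = p *ₚ q} {p′ *ₚ q} refl (*-congʳ p p′ q (λ k → p≈p′ (suc k))))

  *-congˡ : ∀ p q q′ → q ≈ₚ q′ → p *ₚ q ≈ₚ p *ₚ q′
  *-congˡ []      q q′ q≈q′ = ≈ₚ-refl {[]}
  *-congˡ (a ∷ p) q q′ q≈q′ =
    +-cong {map (a *ℤ_) q} {map (a *ℤ_) q′}
      (λ k → trans (coeff-scale a q k) (trans (cong (a *ℤ_) (q≈q′ k)) (sym (coeff-scale a q′ k))))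
      (∷-cong {p = p *ₚ q} {p *ₚ q′} refl (*-congˡ p q q′ q≈q′))

  *-comm : ∀ p q → p *ₚ q ≈ₚ q *ₚ p
  *-comm []      q       = ≈ₚ-sym {q *ₚ []} {[]} (*-zeroʳ q)
  *-comm (a ∷ p) []      = *-zeroʳ (a ∷ p)
  *-comm (a ∷ p) (b ∷ q) zero    = cong (_+ℤ 0ℤ) (ℤ.*-comm a b)
  *-comm (a ∷ p) (b ∷ q) (suc k) = begin
    coeff (map (a *ℤ_) q +ₚ p *ₚ (b ∷ q)) k                     ≡⟨ coeff-+ (map (a *ℤ_) q) _ k ⟩
    coeff (map (a *ℤ_) q) k +ℤ coeff (p *ₚ (b ∷ q)) k           ≡⟨ cong₂ _+ℤ_ (coeff-scale a q k) (*-comm p (b ∷ q) k) ⟩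
    a *ℤ coeff q k +ℤ coeff ((b ∷ q) *ₚ p) k                    ≡⟨ cong (a *ℤ coeff q k +ℤ_) (coeff-*-∷ b q p k) ⟩
    a *ℤ coeff q k +ℤ (b *ℤ coeff p k +ℤ coeff (0ℤ ∷ q *ₚ p) k) ≡⟨ x∙yz≈y∙xz (a *ℤ coeff q k) (b *ℤ coeff p k) _ ⟩
    b *ℤ coeff p k +ℤ (a *ℤ coeff q k +ℤ coeff (0ℤ ∷ q *ₚ p) k) ≡⟨ cong (λ x → b *ℤ coeff p k +ℤ (a *ℤ coeff q k +ℤ x))
                                                                       (∷-cong {p = q *ₚ p} {p *ₚ q} refl (*-comm q p) k) ⟩
    b *ℤ coeff p k +ℤ (a *ℤ coeff q k +ℤ coeff (0ℤ ∷ p *ₚ q) k) ≡⟨ cong (b *ℤ coeff p k +ℤ_) (sym (coeff-*-∷ a p q k)) ⟩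
    b *ℤ coeff p k +ℤ coeff ((a ∷ p) *ₚ q) k                    ≡⟨ cong₂ _+ℤ_ (sym (coeff-scale b p k)) (*-comm (a ∷ p) q k) ⟩
    coeff (map (b *ℤ_) p) k +ℤ coeff (q *ₚ (a ∷ p)) k           ≡⟨ sym (coeff-+ (map (b *ℤ_) p) _ k) ⟩
    coeff (map (b *ℤ_) p +ₚ q *ₚ (a ∷ p)) k                     ∎
    where
    open ≡-Reasoning
    open CommutativeSemigroupProperties ℤ.+-commutativeSemigroup using (x∙yz≈y∙xz)

  *-distribʳ-+ : ∀ q p p′ → (p +ₚ p′) *ₚ q ≈ₚ p *ₚ q +ₚ p′ *ₚ q
  *-distribʳ-+ q []      p′       k = refl
  *-distribʳ-+ q (a ∷ p) []       k = sym (+-identityʳ ((a ∷ p) *ₚ q) k)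
  *-distribʳ-+ q (a ∷ p) (b ∷ p′) k = begin
    coeff ((a +ℤ b ∷ p +ₚ p′) *ₚ q) k                                  ≡⟨ coeff-*-∷ (a +ℤ b) (p +ₚ p′) q k ⟩
    (a +ℤ b) *ℤ x +ℤ coeff (0ℤ ∷ (p +ₚ p′) *ₚ q) k                     ≡⟨ cong ((a +ℤ b) *ℤ x +ℤ_)
                                                                              (∷-cong {p = (p +ₚ p′) *ₚ q} {p *ₚ q +ₚ p′ *ₚ q} refl (*-distribʳ-+ q p p′) k) ⟩
    (a +ℤ b) *ℤ x +ℤ coeff ((0ℤ ∷ p *ₚ q) +ₚ (0ℤ ∷ p′ *ₚ q)) k          ≡⟨ cong ((a +ℤ b) *ℤ x +ℤ_) (coeff-+ (0ℤ ∷ p *ₚ q) (0ℤ ∷ p′ *ₚ q) k) ⟩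
    (a +ℤ b) *ℤ x +ℤ (coeff (0ℤ ∷ p *ₚ q) k +ℤ coeff (0ℤ ∷ p′ *ₚ q) k) ≡⟨ regroup a b x _ _ ⟩
    (a *ℤ x +ℤ coeff (0ℤ ∷ p *ₚ q) k) +ℤ (b *ℤ x +ℤ coeff (0ℤ ∷ p′ *ₚ q) k)
      ≡⟨ sym (trans (coeff-+ ((a ∷ p) *ₚ q) _ k) (cong₂ _+ℤ_ (coeff-*-∷ a p q k) (coeff-*-∷ b p′ q k))) ⟩
    coeff ((a ∷ p) *ₚ q +ₚ (b ∷ p′) *ₚ q) k                            ∎
    where
    open ≡-Reasoning
    x : ℤ
    x = coeff q k
    regroup : ∀ a b x y z → (a +ℤ b) *ℤ x +ℤ (y +ℤ z) ≡ (a *ℤ x +ℤ y) +ℤ (b *ℤ x +ℤ z)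
    regroup = solve-∀

  *-distribˡ-+ : ∀ q p p′ → q *ₚ (p +ₚ p′) ≈ₚ q *ₚ p +ₚ q *ₚ p′
  *-distribˡ-+ q p p′ k = begin
    coeff (q *ₚ (p +ₚ p′)) k                ≡⟨ *-comm q (p +ₚ p′) k ⟩
    coeff ((p +ₚ p′) *ₚ q) k                ≡⟨ *-distribʳ-+ q p p′ k ⟩
    coeff (p *ₚ q +ₚ p′ *ₚ q) k             ≡⟨ +-cong {p *ₚ q} {q *ₚ p} {p′ *ₚ q} {q *ₚ p′} (*-comm p q) (*-comm p′ q) k ⟩
    coeff (q *ₚ p +ₚ q *ₚ p′) k             ∎
    where open ≡-Reasoning

  *-scaleˡ : ∀ a q r → map (a *ℤ_) q *ₚ r ≈ₚ map (a *ℤ_) (q *ₚ r)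
  *-scaleˡ a []      r k = refl
  *-scaleˡ a (b ∷ q) r k = begin
    coeff ((a *ℤ b ∷ map (a *ℤ_) q) *ₚ r) k                     ≡⟨ coeff-*-∷ (a *ℤ b) (map (a *ℤ_) q) r k ⟩
    a *ℤ b *ℤ coeff r k +ℤ coeff (0ℤ ∷ map (a *ℤ_) q *ₚ r) k    ≡⟨ cong (a *ℤ b *ℤ coeff r k +ℤ_)
                                                                      (∷-cong {p = map (a *ℤ_) q *ₚ r} {map (a *ℤ_) (q *ₚ r)} (sym (ℤ.*-zeroʳ a)) (*-scaleˡ a q r) k) ⟩
    a *ℤ b *ℤ coeff r k +ℤ coeff (map (a *ℤ_) (0ℤ ∷ q *ₚ r)) k  ≡⟨ cong (a *ℤ b *ℤ coeff r k +ℤ_) (coeff-scale a (0ℤ ∷ q *ₚ r) k) ⟩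
    a *ℤ b *ℤ coeff r k +ℤ a *ℤ coeff (0ℤ ∷ q *ₚ r) k           ≡⟨ factor a b (coeff r k) _ ⟩
    a *ℤ (b *ℤ coeff r k +ℤ coeff (0ℤ ∷ q *ₚ r) k)              ≡⟨ cong (a *ℤ_) (sym (coeff-*-∷ b q r k)) ⟩
    a *ℤ coeff ((b ∷ q) *ₚ r) k                                 ≡⟨ sym (coeff-scale a ((b ∷ q) *ₚ r) k) ⟩
    coeff (map (a *ℤ_) ((b ∷ q) *ₚ r)) k                        ∎
    where
    open ≡-Reasoning
    factor : ∀ a b x y → a *ℤ b *ℤ x +ℤ a *ℤ y ≡ a *ℤ (b *ℤ x +ℤ y)
    factor = solve-∀

  *-assoc : ∀ p q r → (p *ₚ q) *ₚ r ≈ₚ p *ₚ (q *ₚ r)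
  *-assoc []      q r k = refl
  *-assoc (a ∷ p) q r k = begin
    coeff ((map (a *ℤ_) q +ₚ (0ℤ ∷ p *ₚ q)) *ₚ r) k                   ≡⟨ *-distribʳ-+ r (map (a *ℤ_) q) _ k ⟩
    coeff (map (a *ℤ_) q *ₚ r +ₚ (0ℤ ∷ p *ₚ q) *ₚ r) k                ≡⟨ coeff-+ (map (a *ℤ_) q *ₚ r) _ k ⟩
    coeff (map (a *ℤ_) q *ₚ r) k +ℤ coeff ((0ℤ ∷ p *ₚ q) *ₚ r) k      ≡⟨ cong₂ _+ℤ_ (*-scaleˡ a q r k) shifted ⟩
    coeff (map (a *ℤ_) (q *ₚ r)) k +ℤ coeff (0ℤ ∷ p *ₚ (q *ₚ r)) k    ≡⟨ sym (coeff-+ (map (a *ℤ_) (q *ₚ r)) _ k) ⟩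
    coeff (map (a *ℤ_) (q *ₚ r) +ₚ (0ℤ ∷ p *ₚ (q *ₚ r))) k            ∎
    where
    open ≡-Reasoning
    shifted : coeff ((0ℤ ∷ p *ₚ q) *ₚ r) k ≡ coeff (0ℤ ∷ p *ₚ (q *ₚ r)) k
    shifted = begin
      coeff ((0ℤ ∷ p *ₚ q) *ₚ r) k                        ≡⟨ coeff-*-∷ 0ℤ (p *ₚ q) r k ⟩
      0ℤ *ℤ coeff r k +ℤ coeff (0ℤ ∷ (p *ₚ q) *ₚ r) k    ≡⟨ trans (cong (_+ℤ coeff (0ℤ ∷ (p *ₚ q) *ₚ r) k) (ℤ.*-zeroˡ (coeff r k))) (ℤ.+-identityˡ _) ⟩
      coeff (0ℤ ∷ (p *ₚ q) *ₚ r) k                        ≡⟨ ∷-cong {p = (p *ₚ q) *ₚ r} {p *ₚ (q *ₚ r)} refl (*-assoc p q r) k ⟩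
      coeff (0ℤ ∷ p *ₚ (q *ₚ r)) k                        ∎

  *-identityˡ : ∀ p → 1ₚ *ₚ p ≈ₚ p
  *-identityˡ p k = begin
    coeff (1ₚ *ₚ p) k                      ≡⟨ coeff-*-∷ 1ℤ [] p k ⟩
    1ℤ *ℤ coeff p k +ℤ coeff (0ℤ ∷ []) k  ≡⟨ cong₂ _+ℤ_ (ℤ.*-identityˡ (coeff p k)) (coeff-0∷[] k) ⟩
    coeff p k +ℤ 0ℤ                        ≡⟨ ℤ.+-identityʳ (coeff p k) ⟩
    coeff p k                              ∎
    where
    open ≡-Reasoning
    coeff-0∷[] : ∀ k → coeff (0ℤ ∷ []) k ≡ 0ℤ
    coeff-0∷[] zero    = refl
    coeff-0∷[] (suc k) = refl

  *-identityʳ : ∀ p → p *ₚ 1ₚ ≈ₚ p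
  *-identityʳ p k = trans (*-comm p 1ₚ k) (*-identityˡ p k)

  -- _≈ₚ_ unfolds to a Π-type, so Agda cannot infer the polynomials it relates;
  -- the ring bundle therefore uses this record wrapper.
  record _≋_ (p q : Poly) : Set where
    constructor ≈ₚ⇒≋
    field ≋⇒≈ₚ : p ≈ₚ q

  open _≋_ public

  infix 4 _≋_

  polyRing : CommutativeRing 0ℓ 0ℓ
  polyRing = record
    { Carrier = Poly ; _≈_ = _≋_ ; _+_ = _+ₚ_ ; _*_ = _*ₚ_ ; -_ = -ₚ_ ; 0# = 0ₚ ; 1# = 1ₚ
    ; isCommutativeRing = record
      { isRing = record
        { +-isAbelianGroup = record
          { isGroup = record
            { isMonoid = record
              { isSemigroup = record
                { isMagma = record
                  { isEquivalence = record
                    { refl  = ≈ₚ⇒≋ (λ k → refl)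
                    ; sym   = λ p≋q → ≈ₚ⇒≋ (λ k → sym (≋⇒≈ₚ p≋q k))
                    ; trans = λ p≋q q≋r → ≈ₚ⇒≋ (λ k → trans (≋⇒≈ₚ p≋q k) (≋⇒≈ₚ q≋r k)) }
                  ; ∙-cong = λ {p} {p′} {q} {q′} p≋p′ q≋q′ → ≈ₚ⇒≋ (+-cong {p} {p′} {q} {q′} (≋⇒≈ₚ p≋p′) (≋⇒≈ₚ q≋q′)) }
                ; assoc = λ p q r → ≈ₚ⇒≋ (+-assoc p q r) }
              ; identity = (λ p → ≈ₚ⇒≋ (+-identityˡ p)) , (λ p → ≈ₚ⇒≋ (+-identityʳ p)) }
            ; inverse = (λ p → ≈ₚ⇒≋ (-‿inverseˡ p)) , (λ p → ≈ₚ⇒≋ (-‿inverseʳ p))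
            ; ⁻¹-cong = λ {p} {q} p≋q → ≈ₚ⇒≋ (-‿cong {p} {q} (≋⇒≈ₚ p≋q)) }
          ; comm = λ p q → ≈ₚ⇒≋ (+-comm p q) }
        ; *-cong = λ {p} {p′} {q} {q′} p≋p′ q≋q′ →
            ≈ₚ⇒≋ (λ k → trans (*-congʳ p p′ q (≋⇒≈ₚ p≋p′) k) (*-congˡ p′ q q′ (≋⇒≈ₚ q≋q′) k))
        ; *-assoc = λ p q r → ≈ₚ⇒≋ (*-assoc p q r)
        ; *-identity = (λ p → ≈ₚ⇒≋ (*-identityˡ p)) , (λ p → ≈ₚ⇒≋ (*-identityʳ p))
        ; distrib = (λ p q r → ≈ₚ⇒≋ (*-distribˡ-+ p q r)) , (λ p q r → ≈ₚ⇒≋ (*-distribʳ-+ p q r)) }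
      ; *-comm = λ p q → ≈ₚ⇒≋ (*-comm p q) } }

module RingIdentities {c ℓ} (R : Ring c ℓ) where

  open Ring R
  open import Relation.Binary.Reasoning.Setoid setoid
  open import Algebra.Properties.Ring R using (-‿distribˡ-*; -‿distribʳ-*; -0#≈0#; -‿involutive)
  open import Algebra.Properties.AbelianGroup +-abelianGroup using (⁻¹-∙-comm)
  open import Algebra.Properties.CommutativeSemigroup +-commutativeSemigroup using (interchange)

  x-0#≈x : ∀ x → x - 0# ≈ x
  x-0#≈x x = trans (+-congˡ -0#≈0#) (+-identityʳ x)

  x≈0⇒-x≈0 : ∀ {x} → x ≈ 0# → - x ≈ 0#
  x≈0⇒-x≈0 x≈0 = trans (-‿cong x≈0) -0#≈0#

  -‿distrib-+ : ∀ x y → - (x + y) ≈ - x + - y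
  -‿distrib-+ x y = sym (⁻¹-∙-comm x y)

  -[x-y]≈-x+y : ∀ x y → - (x - y) ≈ - x + y
  -[x-y]≈-x+y x y = trans (-‿distrib-+ x (- y)) (+-congˡ (-‿involutive y))

  [x+y]-[z+w]≈[x-z]+[y-w] : ∀ x y z w → (x + y) - (z + w) ≈ (x - z) + (y - w)
  [x+y]-[z+w]≈[x-z]+[y-w] x y z w = trans (+-congˡ (-‿distrib-+ z w)) (interchange x y (- z) (- w))

  -x-[-y]≈-[x-y] : ∀ x y → - x - (- y) ≈ - (x - y)
  -x-[-y]≈-[x-y] x y = sym (-‿distrib-+ x (- y))

  x*y-x*z≈x*[y-z] : ∀ x y z → x * y - x * z ≈ x * (y - z)
  x*y-x*z≈x*[y-z] x y z = trans (+-congˡ (-‿distribʳ-* x z)) (sym (distribˡ x y (- z)))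

  y*x-z*x≈[y-z]*x : ∀ x y z → y * x - z * x ≈ (y - z) * x
  y*x-z*x≈[y-z]*x x y z = trans (+-congˡ (-‿distribˡ-* z x)) (sym (distribʳ x y (- z)))

  x-[y+z]≈x-y-z : ∀ x y z → x - (y + z) ≈ x - y - z
  x-[y+z]≈x-y-z x y z = trans (+-congˡ (-‿distrib-+ y z)) (sym (+-assoc x (- y) (- z)))

  x-[y-z]≈x-y+z : ∀ x y z → x - (y - z) ≈ x - y + z
  x-[y-z]≈x-y+z x y z = trans (x-[y+z]≈x-y-z x y (- z)) (+-congˡ (-‿involutive z))

  x-[x-y]≈y : ∀ x y → x - (x - y) ≈ y
  x-[x-y]≈y x y = begin
    x - (x - y) ≈⟨ x-[y-z]≈x-y+z x x y ⟩
    x - x + y   ≈⟨ +-congʳ (-‿inverseʳ x) ⟩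
    0# + y      ≈⟨ +-identityˡ y ⟩
    y           ∎

  x-[y-[-z]]≈-[y-[x-z]] : ∀ x y z → x - (y - (- z)) ≈ - (y - (x - z))
  x-[y-[-z]]≈-[y-[x-z]] x y z = begin
    x - (y - (- z))  ≈⟨ x-[y-z]≈x-y+z x y (- z) ⟩
    x - y - z        ≈⟨ +-assoc x (- y) (- z) ⟩
    x + (- y - z)    ≈⟨ +-comm x _ ⟩
    - y - z + x      ≈⟨ +-assoc (- y) (- z) x ⟩
    - y + (- z + x)  ≈⟨ +-congˡ (+-comm (- z) x) ⟩
    - y + (x - z)    ≈⟨ sym (-[x-y]≈-x+y y (x - z)) ⟩
    - (y - (x - z))  ∎

module LaplaceDeterminant {c ℓ} (R : CommutativeRing c ℓ) where

  open import Data.Nat using (ℕ; zero; suc; _≤_; _<_; s≤s)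
  import Data.Nat.Properties as ℕ
  open import Data.Bool using (if_then_else_)
  open import Data.List using (List; []; _∷_; _++_; map; length)
  import Data.List.Properties as List
  open import Data.List.Relation.Unary.All as All using (All; []; _∷_)
  open import Data.List.Relation.Unary.All.Properties using (All¬⇒¬Any)
  open import Data.List.Relation.Unary.Any using (here; there)
  open import Data.List.Relation.Unary.Unique.Propositional using (Unique)
  open import Data.List.Relation.Unary.AllPairs as AllPairs using (_∷_)
  open import Data.List.Relation.Binary.Pointwise as Pointwise using (Pointwise; []; _∷_)
  open import Data.List.Relation.Binary.Permutation.Propositional as ↭ using (_↭_)
  open import Data.List.Membership.Propositional using (_∈_; _∉_)
  open import Data.List.Membership.Propositional.Properties using (∈-∃++; ∈-map⁺; ∈-++⁻)
  open import Data.Product using (∃₂; _,_; _×_; proj₂)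
  open import Data.Sum using (inj₁; inj₂)
  open import Data.Empty using (⊥-elim)
  open import Data.Unit using (⊤)
  open import Function using (_∘_)
  open import Level using (_⊔_)
  open import Relation.Nullary using (yes; no; does)
  open import Relation.Nullary.Decidable using (dec-true; dec-false)
  open import Relation.Binary.Definitions using (DecidableEquality)
  open import Relation.Binary.PropositionalEquality as ≡ using (_≡_; _≢_)

  open CommutativeRing R
  open RingIdentities ring
  open import Relation.Binary.Reasoning.Setoid setoid
  open import Algebra.Properties.Ring ring using (-‿distribʳ-*; -0#≈0#; -‿involutive)
  open import Algebra.Properties.CommutativeSemigroup *-commutativeSemigroup using (x∙yz≈y∙xz)

  module _ {V : Set} where

    Row : Set c
    Row = V → Carrier

    -- Expansion along the row f, where minor L is the determinant of the remaining
    -- rows on the columns L: the recursion unfolds to Σⱼ (-1)ʲ f cⱼ · minor (C without cⱼ).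
    laplace : Row → (List V → Carrier) → List V → Carrier
    laplace f minor []      = 0#
    laplace f minor (x ∷ C) = f x * minor C - laplace f (λ L → minor (x ∷ L)) C

    detRows : List Row → List V → Carrier
    detRows []       []      = 1#
    detRows []       (_ ∷ _) = 0#
    detRows (f ∷ fs) C       = laplace f (detRows fs) C

    data Drop₁ : List V → List V → Set where
      drop-head : ∀ {x C} → Drop₁ C (x ∷ C)
      keep-head : ∀ {x L C} → Drop₁ L C → Drop₁ (x ∷ L) (x ∷ C)

    Drop₁-length : ∀ {L C} → Drop₁ L C → suc (length L) ≡ length C
    Drop₁-length drop-head     = ≡.refl
    Drop₁-length (keep-head d) = ≡.cong suc (Drop₁-length d)

    Drop₁-All : ∀ {p} {P : V → Set p} {L C} → Drop₁ L C → All P C → All P L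
    Drop₁-All drop-head     (_ ∷ ps) = ps
    Drop₁-All (keep-head d) (p ∷ ps) = p ∷ Drop₁-All d ps

    laplace-cong : ∀ {f g : Row} {d d′ : List V → Carrier} C →
                   All (λ x → f x ≈ g x) C → (∀ L → Drop₁ L C → d L ≈ d′ L) → laplace f d C ≈ laplace g d′ C
    laplace-cong []      []           d≈d′ = refl
    laplace-cong (x ∷ C) (fx≈gx ∷ f≈g) d≈d′ =
      +-cong (*-cong fx≈gx (d≈d′ C drop-head))
             (-‿cong (laplace-cong C f≈g (λ L d → d≈d′ (x ∷ L) (keep-head d))))

    laplace-cong-minors : ∀ (f : Row) {d d′ : List V → Carrier} C →
                          (∀ L → Drop₁ L C → d L ≈ d′ L) → laplace f d C ≈ laplace f d′ C
    laplace-cong-minors f C = laplace-cong C (All.universal (λ _ → refl) C)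

    laplace-congʳ : ∀ (f : Row) {d d′ : List V → Carrier} → (∀ L → d L ≈ d′ L) → ∀ C → laplace f d C ≈ laplace f d′ C
    laplace-congʳ f d≈d′ C = laplace-cong-minors f C (λ L _ → d≈d′ L)

    laplace-zeroʳ : ∀ (f : Row) (d : List V → Carrier) → (∀ L → d L ≈ 0#) → ∀ C → laplace f d C ≈ 0#
    laplace-zeroʳ f d d≈0 []      = refl
    laplace-zeroʳ f d d≈0 (x ∷ C) = begin
      f x * d C - laplace f (λ L → d (x ∷ L)) C ≈⟨ +-cong (*-congˡ (d≈0 C)) (-‿cong (laplace-zeroʳ f _ (λ L → d≈0 (x ∷ L)) C)) ⟩
      f x * 0# - 0#                              ≈⟨ x-0#≈x _ ⟩
      f x * 0#                                   ≈⟨ zeroʳ _ ⟩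
      0#                                         ∎

    laplace-zeroˡ : ∀ (f : Row) (d : List V → Carrier) C → All (λ x → f x ≈ 0#) C → laplace f d C ≈ 0#
    laplace-zeroˡ f d []      []            = refl
    laplace-zeroˡ f d (x ∷ C) (fx≈0 ∷ f≈0) = begin
      f x * d C - laplace f (λ L → d (x ∷ L)) C ≈⟨ +-cong (*-congʳ fx≈0) (-‿cong (laplace-zeroˡ f _ C f≈0)) ⟩
      0# * d C - 0#                              ≈⟨ x-0#≈x _ ⟩
      0# * d C                                   ≈⟨ zeroˡ _ ⟩
      0#                                         ∎

    laplace-+ʳ : ∀ (f : Row) (d e : List V → Carrier) C → laplace f (λ L → d L + e L) C ≈ laplace f d C + laplace f e C
    laplace-+ʳ f d e []      = sym (+-identityʳ 0#)
    laplace-+ʳ f d e (x ∷ C) = begin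
      f x * (d C + e C) - laplace f (λ L → d (x ∷ L) + e (x ∷ L)) C
        ≈⟨ +-cong (distribˡ (f x) (d C) (e C)) (-‿cong (laplace-+ʳ f _ _ C)) ⟩
      (f x * d C + f x * e C) - (laplace f (λ L → d (x ∷ L)) C + laplace f (λ L → e (x ∷ L)) C)
        ≈⟨ [x+y]-[z+w]≈[x-z]+[y-w] _ _ _ _ ⟩
      (f x * d C - laplace f (λ L → d (x ∷ L)) C) + (f x * e C - laplace f (λ L → e (x ∷ L)) C) ∎

    laplace-negʳ : ∀ (f : Row) (d : List V → Carrier) C → laplace f (λ L → - d L) C ≈ - laplace f d C
    laplace-negʳ f d []      = sym -0#≈0#
    laplace-negʳ f d (x ∷ C) = begin
      f x * (- d C) - laplace f (λ L → - d (x ∷ L)) C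
        ≈⟨ +-cong (sym (-‿distribʳ-* (f x) (d C))) (-‿cong (laplace-negʳ f _ C)) ⟩
      - (f x * d C) - (- laplace f (λ L → d (x ∷ L)) C) ≈⟨ -x-[-y]≈-[x-y] _ _ ⟩
      - (f x * d C - laplace f (λ L → d (x ∷ L)) C)     ∎

    laplace-*ʳ : ∀ (f : Row) (k : Carrier) (d : List V → Carrier) C → laplace f (λ L → k * d L) C ≈ k * laplace f d C
    laplace-*ʳ f k d []      = sym (zeroʳ k)
    laplace-*ʳ f k d (x ∷ C) = begin
      f x * (k * d C) - laplace f (λ L → k * d (x ∷ L)) C
        ≈⟨ +-cong (x∙yz≈y∙xz (f x) k (d C)) (-‿cong (laplace-*ʳ f k _ C)) ⟩
      k * (f x * d C) - k * laplace f (λ L → d (x ∷ L)) C ≈⟨ x*y-x*z≈x*[y-z] _ _ _ ⟩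
      k * (f x * d C - laplace f (λ L → d (x ∷ L)) C)     ∎

    laplace-subʳ : ∀ (f : Row) (d e : List V → Carrier) C → laplace f (λ L → d L - e L) C ≈ laplace f d C - laplace f e C
    laplace-subʳ f d e C = trans (laplace-+ʳ f d (λ L → - e L) C) (+-congˡ (laplace-negʳ f e C))

    laplace-linearʳ : ∀ (f : Row) (k : Carrier) (d e : List V → Carrier) C →
                      laplace f (λ L → k * d L - e L) C ≈ k * laplace f d C - laplace f e C
    laplace-linearʳ f k d e C = trans (laplace-subʳ f (λ L → k * d L) e C) (+-congʳ (laplace-*ʳ f k d C))

    laplace-subˡ : ∀ (f g : Row) (d : List V → Carrier) C → laplace (λ v → f v - g v) d C ≈ laplace f d C - laplace g d C
    laplace-subˡ f g d []      = sym (x-0#≈x 0#)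
    laplace-subˡ f g d (x ∷ C) = begin
      (f x - g x) * d C - laplace (λ v → f v - g v) (λ L → d (x ∷ L)) C
        ≈⟨ +-cong (sym (y*x-z*x≈[y-z]*x (d C) (f x) (g x))) (-‿cong (laplace-subˡ f g _ C)) ⟩
      (f x * d C - g x * d C) - (laplace f (λ L → d (x ∷ L)) C - laplace g (λ L → d (x ∷ L)) C)
        ≈⟨ [x+y]-[z+w]≈[x-z]+[y-w] _ _ _ _ ⟩
      (f x * d C - laplace f (λ L → d (x ∷ L)) C) + (- (g x * d C) - (- laplace g (λ L → d (x ∷ L)) C))
        ≈⟨ +-congˡ (-x-[-y]≈-[x-y] _ _) ⟩
      (f x * d C - laplace f (λ L → d (x ∷ L)) C) - (g x * d C - laplace g (λ L → d (x ∷ L)) C) ∎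

    laplace-anticomm : ∀ (f g : Row) (d : List V → Carrier) C →
                       laplace f (laplace g d) C ≈ - laplace g (laplace f d) C
    laplace-anticomm f g d []      = sym -0#≈0#
    laplace-anticomm f g d (x ∷ C) = begin
      f x * laplace g d C - laplace f (λ L → laplace g d (x ∷ L)) C
        ≈⟨ +-congˡ (-‿cong (laplace-linearʳ f (g x) d (laplace g d′) C)) ⟩
      f x * laplace g d C - (g x * laplace f d C - laplace f (laplace g d′) C)
        ≈⟨ +-congˡ (-‿cong (+-congˡ (-‿cong (laplace-anticomm f g d′ C)))) ⟩
      f x * laplace g d C - (g x * laplace f d C - (- laplace g (laplace f d′) C))
        ≈⟨ x-[y-[-z]]≈-[y-[x-z]] _ _ _ ⟩
      - (g x * laplace f d C - (f x * laplace g d C - laplace g (laplace f d′) C))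
        ≈⟨ -‿cong (+-congˡ (-‿cong (sym (laplace-linearʳ g (f x) d (laplace f d′) C)))) ⟩
      - (g x * laplace f d C - laplace g (λ L → laplace f d (x ∷ L)) C) ∎
      where
      d′ : List V → Carrier
      d′ L = d (x ∷ L)

    laplace-equalRows≈0 : ∀ (f : Row) (d : List V → Carrier) C → laplace f (laplace f d) C ≈ 0#
    laplace-equalRows≈0 f d []      = refl
    laplace-equalRows≈0 f d (x ∷ C) = begin
      f x * laplace f d C - laplace f (λ L → laplace f d (x ∷ L)) C
        ≈⟨ +-congˡ (-‿cong (laplace-linearʳ f (f x) d (laplace f d′) C)) ⟩
      f x * laplace f d C - (f x * laplace f d C - laplace f (laplace f d′) C) ≈⟨ x-[x-y]≈y _ _ ⟩
      laplace f (laplace f d′) C                                                ≈⟨ laplace-equalRows≈0 f d′ C ⟩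
      0#                                                                        ∎
      where
      d′ : List V → Carrier
      d′ L = d (x ∷ L)

    Alternating : (List V → Carrier) → Set ℓ
    Alternating d = ∀ xs a b ys → d (xs ++ a ∷ b ∷ ys) ≈ - d (xs ++ b ∷ a ∷ ys)

    AdjacentRepeat≈0 : (List V → Carrier) → Set ℓ
    AdjacentRepeat≈0 d = ∀ xs a ys → d (xs ++ a ∷ a ∷ ys) ≈ 0#

    laplace-alternating : ∀ (f : Row) (d : List V → Carrier) → Alternating d → Alternating (laplace f d)
    laplace-alternating f d alt [] a b ys = begin
      f a * d (b ∷ ys) - (f b * d (a ∷ ys) - laplace f (λ L → d (a ∷ b ∷ L)) ys)
        ≈⟨ +-congˡ (-‿cong (+-congˡ (-‿cong (trans (laplace-congʳ f (alt [] a b) ys) (laplace-negʳ f _ ys))))) ⟩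
      f a * d (b ∷ ys) - (f b * d (a ∷ ys) - (- laplace f (λ L → d (b ∷ a ∷ L)) ys))
        ≈⟨ x-[y-[-z]]≈-[y-[x-z]] _ _ _ ⟩
      - (f b * d (a ∷ ys) - (f a * d (b ∷ ys) - laplace f (λ L → d (b ∷ a ∷ L)) ys)) ∎
    laplace-alternating f d alt (x ∷ xs) a b ys = begin
      f x * d (xs ++ a ∷ b ∷ ys) - laplace f d′ (xs ++ a ∷ b ∷ ys)
        ≈⟨ +-cong (trans (*-congˡ (alt xs a b ys)) (sym (-‿distribʳ-* _ _)))
                  (-‿cong (laplace-alternating f d′ (λ xs′ → alt (x ∷ xs′)) xs a b ys)) ⟩
      - (f x * d (xs ++ b ∷ a ∷ ys)) - (- laplace f d′ (xs ++ b ∷ a ∷ ys))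
        ≈⟨ -x-[-y]≈-[x-y] _ _ ⟩
      - (f x * d (xs ++ b ∷ a ∷ ys) - laplace f d′ (xs ++ b ∷ a ∷ ys)) ∎
      where
      d′ : List V → Carrier
      d′ L = d (x ∷ L)

    laplace-adjacentRepeat≈0 : ∀ (f : Row) (d : List V → Carrier) → AdjacentRepeat≈0 d → AdjacentRepeat≈0 (laplace f d)
    laplace-adjacentRepeat≈0 f d rep≈0 [] a ys = begin
      f a * d (a ∷ ys) - (f a * d (a ∷ ys) - laplace f (λ L → d (a ∷ a ∷ L)) ys) ≈⟨ x-[x-y]≈y _ _ ⟩
      laplace f (λ L → d (a ∷ a ∷ L)) ys                                          ≈⟨ laplace-zeroʳ f _ (rep≈0 [] a) ys ⟩
      0#                                                                          ∎
    laplace-adjacentRepeat≈0 f d rep≈0 (x ∷ xs) a ys = begin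
      f x * d (xs ++ a ∷ a ∷ ys) - laplace f (λ L → d (x ∷ L)) (xs ++ a ∷ a ∷ ys)
        ≈⟨ +-cong (trans (*-congˡ (rep≈0 xs a ys)) (zeroʳ _))
                  (-‿cong (laplace-adjacentRepeat≈0 f (λ L → d (x ∷ L)) (λ xs′ → rep≈0 (x ∷ xs′)) xs a ys)) ⟩
      0# - 0# ≈⟨ x-0#≈x 0# ⟩
      0#      ∎

    detRows-alternating : ∀ fs → Alternating (detRows fs)
    detRows-alternating []       []      a b ys = sym -0#≈0#
    detRows-alternating []       (_ ∷ _) a b ys = sym -0#≈0#
    detRows-alternating (f ∷ fs) = laplace-alternating f (detRows fs) (detRows-alternating fs)

    detRows-adjacentRepeat≈0 : ∀ fs → AdjacentRepeat≈0 (detRows fs)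
    detRows-adjacentRepeat≈0 []       []      a ys = refl
    detRows-adjacentRepeat≈0 []       (_ ∷ _) a ys = refl
    detRows-adjacentRepeat≈0 (f ∷ fs) = laplace-adjacentRepeat≈0 f (detRows fs) (detRows-adjacentRepeat≈0 fs)

    data HasRepeat : List V → Set where
      repeat-head : ∀ {a L} → a ∈ L → HasRepeat (a ∷ L)
      repeat-tail : ∀ {y L} → HasRepeat L → HasRepeat (y ∷ L)

    detRows-repeat≈0 : ∀ fs C → HasRepeat C → detRows fs C ≈ 0#
    detRows-repeat≈0 fs = prefixed []
      where
      d : List V → Carrier
      d = detRows fs

      separated : ∀ ms xs a ys → d (xs ++ a ∷ ms ++ a ∷ ys) ≈ 0#
      separated []       xs a ys = detRows-adjacentRepeat≈0 fs xs a ys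
      separated (m ∷ ms) xs a ys = begin
        d (xs ++ a ∷ m ∷ ms ++ a ∷ ys)     ≈⟨ detRows-alternating fs xs a m (ms ++ a ∷ ys) ⟩
        - d (xs ++ m ∷ a ∷ ms ++ a ∷ ys)   ≡⟨ ≡.cong (λ L → - d L) (List.++-assoc xs (m ∷ []) (a ∷ ms ++ a ∷ ys)) ⟨
        - d ((xs ++ m ∷ []) ++ a ∷ ms ++ a ∷ ys) ≈⟨ x≈0⇒-x≈0 (separated ms (xs ++ m ∷ []) a ys) ⟩
        0#                                 ∎

      prefixed : ∀ pre C → HasRepeat C → d (pre ++ C) ≈ 0#
      prefixed pre (a ∷ L) (repeat-head a∈L) with ∈-∃++ a∈L
      ... | ms , ys , ≡.refl = separated ms pre a ys
      prefixed pre (y ∷ L) (repeat-tail r) =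
        trans (reflexive (≡.cong d (≡.sym (List.++-assoc pre (y ∷ []) L)))) (prefixed (pre ++ y ∷ []) L r)

    signed : ℕ → Carrier → Carrier
    signed zero    x = x
    signed (suc n) x = - signed n x

    signed≈0 : ∀ n {x} → x ≈ 0# → signed n x ≈ 0#
    signed≈0 zero    x≈0 = x≈0
    signed≈0 (suc n) x≈0 = x≈0⇒-x≈0 (signed≈0 n x≈0)

    laplace-++ : ∀ (f : Row) (d : List V → Carrier) xs ys →
      laplace f d (xs ++ ys) ≈ laplace f (λ L → d (L ++ ys)) xs + signed (length xs) (laplace f (λ L → d (xs ++ L)) ys)
    laplace-++ f d []       ys = sym (+-identityˡ _)
    laplace-++ f d (x ∷ xs) ys = begin
      f x * d (xs ++ ys) - laplace f (λ L → d (x ∷ L)) (xs ++ ys)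
        ≈⟨ +-congˡ (-‿cong (laplace-++ f (λ L → d (x ∷ L)) xs ys)) ⟩
      f x * d (xs ++ ys) - (laplace f (λ L → d (x ∷ L ++ ys)) xs + signed (length xs) (laplace f (λ L → d (x ∷ xs ++ L)) ys))
        ≈⟨ x-[y+z]≈x-y-z _ _ _ ⟩
      f x * d (xs ++ ys) - laplace f (λ L → d (x ∷ L ++ ys)) xs - signed (length xs) (laplace f (λ L → d (x ∷ xs ++ L)) ys) ∎

    detRows-wide≈0 : ∀ fs C → length fs < length C → detRows fs C ≈ 0#
    detRows-wide≈0 []       (x ∷ C) _     = refl
    detRows-wide≈0 (f ∷ fs) C       fs<C =
      trans (laplace-cong-minors f {d′ = λ _ → 0#} C (λ L d → detRows-wide≈0 fs L (shorter fs<C (Drop₁-length d))))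
            (laplace-zeroʳ f (λ _ → 0#) (λ _ → refl) C)
      where
      shorter : ∀ {n m k} → suc n < m → suc k ≡ m → n < k
      shorter (s≤s n<k) ≡.refl = n<k

    VanishOn : List Row → List V → Set (c ⊔ ℓ)
    VanishOn fs C = All (λ f → All (λ x → f x ≈ 0#) C) fs

    private
      detRows-zeroBlock : ∀ fs x C₁ C₂ → VanishOn fs (x ∷ C₁) → detRows fs ((x ∷ C₁) ++ C₂) ≈ 0#
      detRows-zeroBlock []       x C₁ C₂ _            = refl
      detRows-zeroBlock (f ∷ fs) x C₁ C₂ (f≈0 ∷ fs≈0) = begin
        laplace f (detRows fs) ((x ∷ C₁) ++ C₂)
          ≈⟨ laplace-++ f (detRows fs) (x ∷ C₁) C₂ ⟩
        laplace f (λ L → detRows fs (L ++ C₂)) (x ∷ C₁) + signed (suc (length C₁)) (laplace f (λ L → detRows fs ((x ∷ C₁) ++ L)) C₂)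
          ≈⟨ +-cong (laplace-zeroˡ f (λ L → detRows fs (L ++ C₂)) (x ∷ C₁) f≈0)
                    (signed≈0 (suc (length C₁)) (laplace-zeroʳ f _ (λ L → detRows-zeroBlock fs x C₁ L fs≈0) C₂)) ⟩
        0# + 0# ≈⟨ +-identityˡ 0# ⟩
        0#      ∎

    -- Expanding along fs₁, a term deleting a column of C₂ is left with more rows of fs₁ than columns of C₁.
    detRows-blockTriangular : ∀ fs₁ fs₂ C₁ C₂ → length fs₁ ≤ length C₁ → VanishOn fs₂ C₁ →
                              detRows (fs₁ ++ fs₂) (C₁ ++ C₂) ≈ detRows fs₁ C₁ * detRows fs₂ C₂
    detRows-blockTriangular []        fs₂ []       C₂ _ _     = sym (*-identityˡ _)
    detRows-blockTriangular []        fs₂ (x ∷ C₁) C₂ _ fs₂≈0 = trans (detRows-zeroBlock fs₂ x C₁ C₂ fs₂≈0) (sym (zeroˡ _))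
    detRows-blockTriangular (f ∷ fs₁) fs₂ C₁       C₂ fs₁≤C₁ fs₂≈0 = begin
      laplace f (detRows (fs₁ ++ fs₂)) (C₁ ++ C₂)
        ≈⟨ laplace-++ f _ C₁ C₂ ⟩
      laplace f (λ L → detRows (fs₁ ++ fs₂) (L ++ C₂)) C₁ + signed (length C₁) (laplace f (λ L → detRows (fs₁ ++ fs₂) (C₁ ++ L)) C₂)
        ≈⟨ +-cong (laplace-cong-minors f C₁ (λ L d → detRows-blockTriangular fs₁ fs₂ L C₂ (shorter fs₁≤C₁ (Drop₁-length d)) (shrink d)))
                  (signed≈0 (length C₁) (laplace-zeroʳ f _ wide≈0 C₂)) ⟩
      laplace f (λ L → detRows fs₁ L * detRows fs₂ C₂) C₁ + 0#
        ≈⟨ +-identityʳ _ ⟩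
      laplace f (λ L → detRows fs₁ L * detRows fs₂ C₂) C₁
        ≈⟨ laplace-congʳ f (λ L → *-comm _ _) C₁ ⟩
      laplace f (λ L → detRows fs₂ C₂ * detRows fs₁ L) C₁
        ≈⟨ laplace-*ʳ f (detRows fs₂ C₂) (detRows fs₁) C₁ ⟩
      detRows fs₂ C₂ * laplace f (detRows fs₁) C₁
        ≈⟨ *-comm _ _ ⟩
      laplace f (detRows fs₁) C₁ * detRows fs₂ C₂ ∎
      where
      shorter : ∀ {n m k} → suc n ≤ m → suc k ≡ m → n ≤ k
      shorter (s≤s n≤k) ≡.refl = n≤k
      shrink : ∀ {L} → Drop₁ L C₁ → VanishOn fs₂ L
      shrink d = All.map (Drop₁-All d) fs₂≈0
      wide≈0 : ∀ L → detRows (fs₁ ++ fs₂) (C₁ ++ L) ≈ 0#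
      wide≈0 L = begin
        detRows (fs₁ ++ fs₂) (C₁ ++ L) ≈⟨ detRows-blockTriangular fs₁ fs₂ C₁ L (ℕ.<⇒≤ fs₁≤C₁) fs₂≈0 ⟩
        detRows fs₁ C₁ * detRows fs₂ L ≈⟨ *-congʳ (detRows-wide≈0 fs₁ C₁ fs₁≤C₁) ⟩
        0# * detRows fs₂ L             ≈⟨ zeroˡ _ ⟩
        0#                             ∎

    detRows-agreeOn : ∀ {p} (P : V → Set p) {fs gs} C → All P C →
                      Pointwise (λ f g → ∀ v → P v → f v ≈ g v) fs gs → detRows fs C ≈ detRows gs C
    detRows-agreeOn P []      _  []           = refl
    detRows-agreeOn P (_ ∷ _) _  []           = refl
    detRows-agreeOn P C       pC (f≈g ∷ fs≈gs) =
      laplace-cong C (All.map (λ {v} → f≈g v) pC) (λ L d → detRows-agreeOn P L (Drop₁-All d pC) fs≈gs)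

    detRows-cong : ∀ {fs gs} → Pointwise (λ f g → ∀ v → f v ≈ g v) fs gs → ∀ C → detRows fs C ≈ detRows gs C
    detRows-cong fs≈gs C =
      detRows-agreeOn (λ _ → ⊤) C (All.universal _ C) (Pointwise.map (λ f≈g v _ → f≈g v) fs≈gs)

    detRows-swapRows : ∀ hs (f g : Row) ks C → detRows (hs ++ f ∷ g ∷ ks) C ≈ - detRows (hs ++ g ∷ f ∷ ks) C
    detRows-swapRows []       f g ks C = laplace-anticomm f g (detRows ks) C
    detRows-swapRows (h ∷ hs) f g ks C =
      trans (laplace-congʳ h (detRows-swapRows hs f g ks) C) (laplace-negʳ h _ C)

    detRows-adjacentRows≈0 : ∀ hs (f : Row) ks C → detRows (hs ++ f ∷ f ∷ ks) C ≈ 0#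
    detRows-adjacentRows≈0 []       f ks C = laplace-equalRows≈0 f (detRows ks) C
    detRows-adjacentRows≈0 (h ∷ hs) f ks C = laplace-zeroʳ h _ (detRows-adjacentRows≈0 hs f ks) C

    detRows-repeatedRow≈0 : ∀ ms hs (f : Row) ks C → detRows (hs ++ f ∷ ms ++ f ∷ ks) C ≈ 0#
    detRows-repeatedRow≈0 []       hs f ks C = detRows-adjacentRows≈0 hs f ks C
    detRows-repeatedRow≈0 (m ∷ ms) hs f ks C = begin
      detRows (hs ++ f ∷ m ∷ ms ++ f ∷ ks) C            ≈⟨ detRows-swapRows hs f m (ms ++ f ∷ ks) C ⟩
      - detRows (hs ++ m ∷ f ∷ ms ++ f ∷ ks) C          ≡⟨ ≡.cong (λ fs → - detRows fs C) (List.++-assoc hs (m ∷ []) (f ∷ ms ++ f ∷ ks)) ⟨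
      - detRows ((hs ++ m ∷ []) ++ f ∷ ms ++ f ∷ ks) C  ≈⟨ x≈0⇒-x≈0 (detRows-repeatedRow≈0 ms (hs ++ m ∷ []) f ks C) ⟩
      0#                                                ∎

    detRows-subRow : ∀ hs (g k : Row) ks C →
                     detRows (hs ++ (λ v → g v - k v) ∷ ks) C ≈ detRows (hs ++ g ∷ ks) C - detRows (hs ++ k ∷ ks) C
    detRows-subRow []       g k ks C = laplace-subˡ g k (detRows ks) C
    detRows-subRow (h ∷ hs) g k ks C =
      trans (laplace-congʳ h (detRows-subRow hs g k ks) C) (laplace-subʳ h (detRows (hs ++ g ∷ ks)) (detRows (hs ++ k ∷ ks)) C)

    Absent : V → List V → Set
    Absent a = All (_≢ a)

    data OccursOnce (a : V) : List V → Set where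
      once-here  : ∀ {C} → Absent a C → OccursOnce a (a ∷ C)
      once-there : ∀ {y C} → y ≢ a → OccursOnce a C → OccursOnce a (y ∷ C)

    OccursOnce⇒∈ : ∀ {a C} → OccursOnce a C → a ∈ C
    OccursOnce⇒∈ (once-here _)    = here ≡.refl
    OccursOnce⇒∈ (once-there _ o) = there (OccursOnce⇒∈ o)

    OccursOnce-split : ∀ {a I} → OccursOnce a I → ∃₂ λ xs ys → I ≡ xs ++ a ∷ ys × Absent a xs × Absent a ys
    OccursOnce-split (once-here a∉C) = [] , _ , ≡.refl , [] , a∉C
    OccursOnce-split (once-there {y} y≢a o) with OccursOnce-split o
    ... | xs , ys , ≡.refl , a∉xs , a∉ys = y ∷ xs , ys , ≡.refl , y≢a ∷ a∉xs , a∉ys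

    Unique⇒OccursOnce : ∀ {a I} → Unique I → a ∈ I → OccursOnce a I
    Unique⇒OccursOnce (x≢I ∷ !I) (here ≡.refl) = once-here (All.map (λ x≢y y≡x → x≢y (≡.sym y≡x)) x≢I)
    Unique⇒OccursOnce (x≢I ∷ !I) (there a∈I)   = once-there (All.lookup x≢I a∈I) (Unique⇒OccursOnce !I a∈I)

    Matrix : Set c
    Matrix = V → Row

    detOn : Matrix → List V → Carrier
    detOn M I = detRows (map M I) I

    detOn-cong : ∀ (M N : Matrix) I → (∀ u v → M u v ≈ N u v) → detOn M I ≈ detOn N I
    detOn-cong M N I M≈N = detRows-cong (Pointwise.map⁺ M N (Pointwise.refl (λ {u} → M≈N u) {I})) I

    detOn-swapAdjacent : ∀ M pre x y rest → detOn M (pre ++ x ∷ y ∷ rest) ≈ detOn M (pre ++ y ∷ x ∷ rest)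
    detOn-swapAdjacent M pre x y rest = begin
      detRows (map M (pre ++ x ∷ y ∷ rest)) (pre ++ x ∷ y ∷ rest)
        ≡⟨ ≡.cong (λ fs → detRows fs (pre ++ x ∷ y ∷ rest)) (List.map-++ M pre (x ∷ y ∷ rest)) ⟩
      detRows (map M pre ++ M x ∷ M y ∷ map M rest) (pre ++ x ∷ y ∷ rest)
        ≈⟨ detRows-swapRows (map M pre) (M x) (M y) (map M rest) _ ⟩
      - detRows (map M pre ++ M y ∷ M x ∷ map M rest) (pre ++ x ∷ y ∷ rest)
        ≈⟨ -‿cong (detRows-alternating (map M pre ++ M y ∷ M x ∷ map M rest) pre x y rest) ⟩
      - - detRows (map M pre ++ M y ∷ M x ∷ map M rest) (pre ++ y ∷ x ∷ rest)
        ≈⟨ -‿involutive _ ⟩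
      detRows (map M pre ++ M y ∷ M x ∷ map M rest) (pre ++ y ∷ x ∷ rest)
        ≡⟨ ≡.cong (λ fs → detRows fs (pre ++ y ∷ x ∷ rest)) (List.map-++ M pre (y ∷ x ∷ rest)) ⟨
      detRows (map M (pre ++ y ∷ x ∷ rest)) (pre ++ y ∷ x ∷ rest) ∎

    private
      detOn-↭-inside : ∀ M {xs ys} → xs ↭ ys → ∀ pre post → detOn M (pre ++ xs ++ post) ≈ detOn M (pre ++ ys ++ post)
      detOn-↭-inside M ↭.refl              pre post = refl
      detOn-↭-inside M (↭.trans p q)       pre post = trans (detOn-↭-inside M p pre post) (detOn-↭-inside M q pre post)
      detOn-↭-inside M (↭.prep {xs} {ys} x p) pre post = begin
        detOn M (pre ++ x ∷ xs ++ post)        ≡⟨ ≡.cong (detOn M) (List.++-assoc pre (x ∷ []) (xs ++ post)) ⟨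
        detOn M ((pre ++ x ∷ []) ++ xs ++ post) ≈⟨ detOn-↭-inside M p (pre ++ x ∷ []) post ⟩
        detOn M ((pre ++ x ∷ []) ++ ys ++ post) ≡⟨ ≡.cong (detOn M) (List.++-assoc pre (x ∷ []) (ys ++ post)) ⟩
        detOn M (pre ++ x ∷ ys ++ post)        ∎
      detOn-↭-inside M (↭.swap {xs} {ys} x y p) pre post = begin
        detOn M (pre ++ x ∷ y ∷ xs ++ post)          ≈⟨ detOn-swapAdjacent M pre x y (xs ++ post) ⟩
        detOn M (pre ++ y ∷ x ∷ xs ++ post)          ≡⟨ ≡.cong (detOn M) (List.++-assoc pre (y ∷ x ∷ []) (xs ++ post)) ⟨
        detOn M ((pre ++ y ∷ x ∷ []) ++ xs ++ post)   ≈⟨ detOn-↭-inside M p (pre ++ y ∷ x ∷ []) post ⟩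
        detOn M ((pre ++ y ∷ x ∷ []) ++ ys ++ post)   ≡⟨ ≡.cong (detOn M) (List.++-assoc pre (y ∷ x ∷ []) (ys ++ post)) ⟩
        detOn M (pre ++ y ∷ x ∷ ys ++ post)          ∎

    detOn-↭ : ∀ M {I J} → I ↭ J → detOn M I ≈ detOn M J
    detOn-↭ M {I} {J} I↭J = begin
      detOn M I           ≡⟨ ≡.cong (detOn M) (List.++-identityʳ I) ⟨
      detOn M (I ++ [])   ≈⟨ detOn-↭-inside M I↭J [] [] ⟩
      detOn M (J ++ [])   ≡⟨ ≡.cong (detOn M) (List.++-identityʳ J) ⟩
      detOn M J           ∎

    module _ (_≟_ : DecidableEquality V) where

      open import Data.List.Membership.DecPropositional _≟_ using (_∈?_)

      addColumn : V → V → Row → Row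
      addColumn a a′ f v = if does (v ≟ a) then f v + f a′ else f v

      renameColumn : V → V → V → V
      renameColumn a a′ v = if does (v ≟ a) then a′ else v

      addColumn-at : ∀ a a′ f → addColumn a a′ f a ≡ f a + f a′
      addColumn-at a a′ f rewrite dec-true (a ≟ a) ≡.refl = ≡.refl

      addColumn-off : ∀ a a′ f {y} → y ≢ a → addColumn a a′ f y ≡ f y
      addColumn-off a a′ f {y} y≢a rewrite dec-false (y ≟ a) y≢a = ≡.refl

      renameColumn-at : ∀ a a′ → renameColumn a a′ a ≡ a′
      renameColumn-at a a′ rewrite dec-true (a ≟ a) ≡.refl = ≡.refl

      renameColumn-off : ∀ a a′ {y} → y ≢ a → renameColumn a a′ y ≡ y
      renameColumn-off a a′ {y} y≢a rewrite dec-false (y ≟ a) y≢a = ≡.refl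

      renameColumn-absent : ∀ a a′ {L} → Absent a L → map (renameColumn a a′) L ≡ L
      renameColumn-absent a a′ []           = ≡.refl
      renameColumn-absent a a′ (y≢a ∷ a∉L) = ≡.cong₂ _∷_ (renameColumn-off a a′ y≢a) (renameColumn-absent a a′ a∉L)

      -- By linearity in column a, adding column a′ to it adds the determinant whose column
      -- list has a renamed to a′; when a′ is already a column, that determinant has a repeated column.
      module _ (a a′ : V) where

        private
          rename : List V → List V
          rename = map (renameColumn a a′)

        laplace-addColumn-absent : ∀ (f : Row) (d d⁺ : List V → Carrier) →
          (∀ L → Absent a L → d⁺ L ≈ d L) →
          ∀ C → Absent a C → laplace (addColumn a a′ f) d⁺ C ≈ laplace f d C
        laplace-addColumn-absent f d d⁺ absent C a∉C =
          laplace-cong C (All.map (λ y≢a → reflexive (addColumn-off a a′ f y≢a)) a∉C)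
                         (λ L d → absent L (Drop₁-All d a∉C))

        laplace-addColumn-once : ∀ (f : Row) (d d⁺ : List V → Carrier) →
          (∀ L → OccursOnce a L → d⁺ L ≈ d L + d (rename L)) →
          (∀ L → Absent a L → d⁺ L ≈ d L) →
          ∀ C → OccursOnce a C → laplace (addColumn a a′ f) d⁺ C ≈ laplace f d C + laplace f d (rename C)
        laplace-addColumn-once f d d⁺ once absent (.a ∷ C) (once-here a∉C) = begin
          addColumn a a′ f a * d⁺ C - laplace (addColumn a a′ f) (λ L → d⁺ (a ∷ L)) C
            ≈⟨ +-cong (*-cong (reflexive (addColumn-at a a′ f)) (absent C a∉C))
                      (-‿cong (laplace-addColumn-absent f (λ L → d (a ∷ L) + d (a′ ∷ L)) (λ L → d⁺ (a ∷ L)) split C a∉C)) ⟩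
          (f a + f a′) * d C - laplace f (λ L → d (a ∷ L) + d (a′ ∷ L)) C
            ≈⟨ +-cong (distribʳ (d C) (f a) (f a′)) (-‿cong (laplace-+ʳ f _ _ C)) ⟩
          (f a * d C + f a′ * d C) - (laplace f (λ L → d (a ∷ L)) C + laplace f (λ L → d (a′ ∷ L)) C)
            ≈⟨ [x+y]-[z+w]≈[x-z]+[y-w] _ _ _ _ ⟩
          laplace f d (a ∷ C) + laplace f d (a′ ∷ C)
            ≡⟨ ≡.cong (λ L → laplace f d (a ∷ C) + laplace f d L) (≡.cong₂ _∷_ (renameColumn-at a a′) (renameColumn-absent a a′ a∉C)) ⟨
          laplace f d (a ∷ C) + laplace f d (rename (a ∷ C)) ∎
          where
          split : ∀ L → Absent a L → d⁺ (a ∷ L) ≈ d (a ∷ L) + d (a′ ∷ L)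
          split L a∉L = trans (once (a ∷ L) (once-here a∉L))
            (reflexive (≡.cong (λ L′ → d (a ∷ L) + d L′) (≡.cong₂ _∷_ (renameColumn-at a a′) (renameColumn-absent a a′ a∉L))))
        laplace-addColumn-once f d d⁺ once absent (y ∷ C) (once-there y≢a o) = begin
          addColumn a a′ f y * d⁺ C - laplace (addColumn a a′ f) (λ L → d⁺ (y ∷ L)) C
            ≈⟨ +-cong (*-cong (reflexive (addColumn-off a a′ f y≢a)) (once C o))
                      (-‿cong (laplace-addColumn-once f (λ L → d (y ∷ L)) (λ L → d⁺ (y ∷ L)) once′ absent′ C o)) ⟩
          f y * (d C + d (rename C)) - (laplace f (λ L → d (y ∷ L)) C + laplace f (λ L → d (y ∷ L)) (rename C))
            ≈⟨ +-congʳ (distribˡ (f y) (d C) (d (rename C))) ⟩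
          (f y * d C + f y * d (rename C)) - (laplace f (λ L → d (y ∷ L)) C + laplace f (λ L → d (y ∷ L)) (rename C))
            ≈⟨ [x+y]-[z+w]≈[x-z]+[y-w] _ _ _ _ ⟩
          laplace f d (y ∷ C) + laplace f d (y ∷ rename C)
            ≡⟨ ≡.cong (λ z → laplace f d (y ∷ C) + laplace f d (z ∷ rename C)) (renameColumn-off a a′ y≢a) ⟨
          laplace f d (y ∷ C) + laplace f d (rename (y ∷ C)) ∎
          where
          once′ : ∀ L → OccursOnce a L → d⁺ (y ∷ L) ≈ d (y ∷ L) + d (y ∷ rename L)
          once′ L oL = trans (once (y ∷ L) (once-there y≢a oL))
            (reflexive (≡.cong (λ z → d (y ∷ L) + d (z ∷ rename L)) (renameColumn-off a a′ y≢a)))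
          absent′ : ∀ L → Absent a L → d⁺ (y ∷ L) ≈ d (y ∷ L)
          absent′ L a∉L = absent (y ∷ L) (y≢a ∷ a∉L)

        detRows-addColumn-absent : ∀ fs C → Absent a C → detRows (map (addColumn a a′) fs) C ≈ detRows fs C
        detRows-addColumn-absent []       C _   = refl
        detRows-addColumn-absent (f ∷ fs) C a∉C =
          laplace-addColumn-absent f (detRows fs) (detRows (map (addColumn a a′) fs)) (detRows-addColumn-absent fs) C a∉C

        detRows-addColumn-once : ∀ fs C → OccursOnce a C → detRows (map (addColumn a a′) fs) C ≈ detRows fs C + detRows fs (rename C)
        detRows-addColumn-once []       (_ ∷ _) _ = sym (+-identityˡ 0#)
        detRows-addColumn-once (f ∷ fs) C       o =
          laplace-addColumn-once f (detRows fs) (detRows (map (addColumn a a′) fs))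
                                 (detRows-addColumn-once fs) (detRows-addColumn-absent fs) C o

        renameColumn-repeat : ∀ C → OccursOnce a C → a′ ∈ C → a′ ≢ a → HasRepeat (rename C)
        renameColumn-repeat (.a ∷ C) (once-here a∉C) (here a′≡a)   a′≢a = ⊥-elim (a′≢a a′≡a)
        renameColumn-repeat (.a ∷ C) (once-here a∉C) (there a′∈C) a′≢a =
          repeat-head (≡.subst₂ _∈_ (≡.sym (renameColumn-at a a′)) (≡.sym (renameColumn-absent a a′ a∉C)) a′∈C)
        renameColumn-repeat (y ∷ C) (once-there y≢a o) (here ≡.refl) a′≢a =
          repeat-head (≡.subst (_∈ rename C) (≡.trans (renameColumn-at a a′) (≡.sym (renameColumn-off a a′ y≢a)))
                               (∈-map⁺ (renameColumn a a′) (OccursOnce⇒∈ o)))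
        renameColumn-repeat (y ∷ C) (once-there y≢a o) (there a′∈C) a′≢a = repeat-tail (renameColumn-repeat C o a′∈C a′≢a)

        detRows-addColumn≈ : ∀ fs C → OccursOnce a C → a′ ∈ C → a′ ≢ a → detRows (map (addColumn a a′) fs) C ≈ detRows fs C
        detRows-addColumn≈ fs C o a′∈C a′≢a = begin
          detRows (map (addColumn a a′) fs) C     ≈⟨ detRows-addColumn-once fs C o ⟩
          detRows fs C + detRows fs (rename C)    ≈⟨ +-congˡ (detRows-repeat≈0 fs _ (renameColumn-repeat C o a′∈C a′≢a)) ⟩
          detRows fs C + 0#                       ≈⟨ +-identityʳ _ ⟩
          detRows fs C                            ∎

      subRow : V → V → Matrix → Matrix
      subRow r r′ M u = if does (u ≟ r) then (λ v → M r v - M r′ v) else M u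

      addCol : V → V → Matrix → Matrix
      addCol a a′ M u = addColumn a a′ (M u)

      private
        detRows-insertPresentRow≈0 : ∀ (M : Matrix) xs r ys {r′} C → r′ ∈ xs ++ r ∷ ys → r′ ≢ r →
                                     detRows (map M xs ++ M r′ ∷ map M ys) C ≈ 0#
        detRows-insertPresentRow≈0 M xs r ys {r′} C r′∈I r′≢r with ∈-++⁻ xs r′∈I
        ... | inj₂ (here r′≡r) = ⊥-elim (r′≢r r′≡r)
        ... | inj₁ r′∈xs with ∈-∃++ r′∈xs
        ...   | p , q , ≡.refl = trans
          (reflexive (≡.cong (λ fs → detRows fs C)
            (≡.trans (≡.cong (_++ M r′ ∷ map M ys) (List.map-++ M p (r′ ∷ q))) (List.++-assoc (map M p) (M r′ ∷ map M q) (M r′ ∷ map M ys)))))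
          (detRows-repeatedRow≈0 (map M q) (map M p) (M r′) (map M ys) C)
        detRows-insertPresentRow≈0 M xs r ys {r′} C r′∈I r′≢r | inj₂ (there r′∈ys) with ∈-∃++ r′∈ys
        ... | p , q , ≡.refl = trans
          (reflexive (≡.cong (λ fs → detRows (map M xs ++ M r′ ∷ fs) C) (List.map-++ M p (r′ ∷ q))))
          (detRows-repeatedRow≈0 (map M p) (map M xs) (M r′) (map M q) C)

        subRow-absent : ∀ r r′ M {xs} → Absent r xs → Pointwise (λ f g → ∀ v → f v ≈ g v) (map (subRow r r′ M) xs) (map M xs)
        subRow-absent r r′ M []           = []
        subRow-absent r r′ M (u≢r ∷ r∉xs) = (λ v → reflexive (≡.cong (λ b → (if b then _ else M _) v) (dec-false (_ ≟ r) u≢r)))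
                                            ∷ subRow-absent r r′ M r∉xs

      detOn-subRow : ∀ r r′ M I → OccursOnce r I → r′ ∈ I → r′ ≢ r → detOn (subRow r r′ M) I ≈ detOn M I
      detOn-subRow r r′ M I o r′∈I r′≢r with OccursOnce-split o
      ... | xs , ys , ≡.refl , r∉xs , r∉ys = begin
        detRows (map (subRow r r′ M) (xs ++ r ∷ ys)) I
          ≡⟨ ≡.cong (λ fs → detRows fs I) (List.map-++ (subRow r r′ M) xs (r ∷ ys)) ⟩
        detRows (map (subRow r r′ M) xs ++ subRow r r′ M r ∷ map (subRow r r′ M) ys) I
          ≈⟨ detRows-cong (Pointwise.++⁺ (subRow-absent r r′ M r∉xs) (row-r ∷ subRow-absent r r′ M r∉ys)) I ⟩
        detRows (map M xs ++ (λ v → M r v - M r′ v) ∷ map M ys) I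
          ≈⟨ detRows-subRow (map M xs) (M r) (M r′) (map M ys) I ⟩
        detRows (map M xs ++ M r ∷ map M ys) I - detRows (map M xs ++ M r′ ∷ map M ys) I
          ≈⟨ +-congˡ (-‿cong (detRows-insertPresentRow≈0 M xs r ys I r′∈I r′≢r)) ⟩
        detRows (map M xs ++ M r ∷ map M ys) I - 0#
          ≈⟨ x-0#≈x _ ⟩
        detRows (map M xs ++ M r ∷ map M ys) I
          ≡⟨ ≡.cong (λ fs → detRows fs I) (List.map-++ M xs (r ∷ ys)) ⟨
        detRows (map M (xs ++ r ∷ ys)) I ∎
        where
        row-r : ∀ v → subRow r r′ M r v ≈ M r v - M r′ v
        row-r v rewrite dec-true (r ≟ r) ≡.refl = refl

      detOn-addCol : ∀ a a′ M I → OccursOnce a I → a′ ∈ I → a′ ≢ a → detOn (addCol a a′ M) I ≈ detOn M I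
      detOn-addCol a a′ M I o a′∈I a′≢a =
        trans (reflexive (≡.cong (λ fs → detRows fs I) (List.map-∘ I))) (detRows-addColumn≈ a a′ (map M I) I o a′∈I a′≢a)

      addColumns : (V → V) → List V → Matrix → Matrix
      addColumns σ S M u v = if does (v ∈? S) then M u v + M u (σ v) else M u v

      subRows : (V → V) → List V → Matrix → Matrix
      subRows τ S M u v = if does (u ∈? S) then M u v - M (τ u) v else M u v

      -- σ s ∉ S lets the simultaneous operations be performed one at a time.
      PairedWithin : (V → V) → List V → List V → Set
      PairedWithin σ S I = ∀ {s} → s ∈ S → s ∈ I × σ s ∈ I × σ s ∉ S

      private
        addColumns-∷ : ∀ σ s S M → s ∉ S → σ s ∉ S → ∀ u v → addColumns σ (s ∷ S) M u v ≡ addCol s (σ s) (addColumns σ S M) u v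
        addColumns-∷ σ s S M s∉S σs∉S u v with v ≟ s
        ... | yes ≡.refl rewrite dec-false (s ∈? S) s∉S | dec-false (σ s ∈? S) σs∉S = ≡.refl
        ... | no  _      = ≡.refl

        subRows-∷ : ∀ τ s S M → s ∉ S → τ s ∉ S → ∀ u v → subRows τ (s ∷ S) M u v ≡ subRow s (τ s) (subRows τ S M) u v
        subRows-∷ τ s S M s∉S τs∉S u v with u ≟ s
        ... | yes ≡.refl rewrite dec-false (s ∈? S) s∉S | dec-false (τ s ∈? S) τs∉S = ≡.refl
        ... | no  _      = ≡.refl

        head∉tail : ∀ {s : V} {S} → Unique (s ∷ S) → s ∉ S
        head∉tail (s≢S ∷ _) = All¬⇒¬Any s≢S

        PairedWithin-tail : ∀ {σ s S I} → PairedWithin σ (s ∷ S) I → PairedWithin σ S I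
        PairedWithin-tail paired s∈S with paired (there s∈S)
        ... | s∈I , σs∈I , σs∉sS = s∈I , σs∈I , λ σs∈S → σs∉sS (there σs∈S)

        σ-moves : ∀ {σ s S I} → PairedWithin σ S I → s ∈ S → σ s ≢ s
        σ-moves paired s∈S σs≡s = proj₂ (proj₂ (paired s∈S)) (≡.subst (_∈ _) (≡.sym σs≡s) s∈S)

      detOn-addColumns : ∀ σ S M I → Unique S → Unique I → PairedWithin σ S I → detOn (addColumns σ S M) I ≈ detOn M I
      detOn-addColumns σ []      M I _  _  _      = refl
      detOn-addColumns σ (s ∷ S) M I !S !I paired with paired (here ≡.refl)
      ... | s∈I , σs∈I , σs∉sS = begin
        detOn (addColumns σ (s ∷ S) M) I          ≈⟨ detOn-cong _ _ I (λ u v → reflexive (addColumns-∷ σ s S M (head∉tail !S) (σs∉sS ∘ there) u v)) ⟩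
        detOn (addCol s (σ s) (addColumns σ S M)) I ≈⟨ detOn-addCol s (σ s) _ I (Unique⇒OccursOnce !I s∈I) σs∈I (σ-moves paired (here ≡.refl)) ⟩
        detOn (addColumns σ S M) I                ≈⟨ detOn-addColumns σ S M I (AllPairs.tail !S) !I (PairedWithin-tail paired) ⟩
        detOn M I                                 ∎

      detOn-subRows : ∀ τ S M I → Unique S → Unique I → PairedWithin τ S I → detOn (subRows τ S M) I ≈ detOn M I
      detOn-subRows τ []      M I _  _  _      = refl
      detOn-subRows τ (s ∷ S) M I !S !I paired with paired (here ≡.refl)
      ... | s∈I , τs∈I , τs∉sS = begin
        detOn (subRows τ (s ∷ S) M) I           ≈⟨ detOn-cong _ _ I (λ u v → reflexive (subRows-∷ τ s S M (head∉tail !S) (τs∉sS ∘ there) u v)) ⟩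
        detOn (subRow s (τ s) (subRows τ S M)) I ≈⟨ detOn-subRow s (τ s) _ I (Unique⇒OccursOnce !I s∈I) τs∈I (σ-moves paired (here ≡.refl)) ⟩
        detOn (subRows τ S M) I                 ≈⟨ detOn-subRows τ S M I (AllPairs.tail !S) !I (PairedWithin-tail paired) ⟩
        detOn M I                               ∎

module DefsDeterminant where

  open PolynomialRing using (_≋_; polyRing)
  open import Data.Bool using (Bool; true; false)
  open import Data.List using (List; []; _∷_; _++_; map)
  import Data.List.Properties as List
  open import Relation.Binary.PropositionalEquality as ≡ using ()
  open CommutativeRing polyRing using (setoid; refl; trans; reflexive; +-congˡ; -‿cong)
  open LaplaceDeterminant polyRing
  open RingIdentities (CommutativeRing.ring polyRing) using (-[x-y]≈-x+y)
  open import Relation.Binary.Reasoning.Setoid setoid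

  signedBy : Bool → Poly → Poly
  signedBy true  p = p
  signedBy false p = -ₚ p

  module _ {V : Set} (M : V → V → Poly) where

    private
      laplace-move-column : ∀ r (d : List V → Poly) before c cs →
        laplace (M r) (λ L → d ((before ++ c ∷ []) ++ L)) cs ≋ laplace (M r) (λ L → d (before ++ c ∷ L)) cs
      laplace-move-column r d before c =
        laplace-congʳ (M r) (λ L → reflexive (≡.cong d (List.++-assoc before (c ∷ []) L)))

    expand≋laplace : ∀ r d before cs s → expand M r d before cs s ≋ signedBy s (laplace (M r) (λ L → d (before ++ L)) cs)
    expand≋laplace r d before []       true  = refl
    expand≋laplace r d before []       false = refl
    expand≋laplace r d before (c ∷ cs) true  = begin
      M r c *ₚ d (before ++ cs) +ₚ expand M r d (before ++ c ∷ []) cs false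
        ≈⟨ +-congˡ (trans (expand≋laplace r d (before ++ c ∷ []) cs false) (-‿cong (laplace-move-column r d before c cs))) ⟩
      M r c *ₚ d (before ++ cs) +ₚ (-ₚ laplace (M r) (λ L → d (before ++ c ∷ L)) cs) ∎
    expand≋laplace r d before (c ∷ cs) false = begin
      (-ₚ (M r c *ₚ d (before ++ cs))) +ₚ expand M r d (before ++ c ∷ []) cs true
        ≈⟨ +-congˡ (trans (expand≋laplace r d (before ++ c ∷ []) cs true) (laplace-move-column r d before c cs)) ⟩
      (-ₚ (M r c *ₚ d (before ++ cs))) +ₚ laplace (M r) (λ L → d (before ++ c ∷ L)) cs
        ≈⟨ -[x-y]≈-x+y (M r c *ₚ d (before ++ cs)) _ ⟨
      -ₚ (M r c *ₚ d (before ++ cs) +ₚ (-ₚ laplace (M r) (λ L → d (before ++ c ∷ L)) cs)) ∎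

    detSub≋detRows : ∀ rs cs → detSub M rs cs ≋ detRows (map M rs) cs
    detSub≋detRows []       []      = refl
    detSub≋detRows []       (_ ∷ _) = refl
    detSub≋detRows (r ∷ rs) cs      =
      trans (expand≋laplace r (detSub M rs) [] cs true) (laplace-congʳ (M r) (detSub≋detRows rs) cs)

    det≋detOn : ∀ I → det M I ≋ detOn M I
    det≋detOn I = detSub≋detRows I I

module ListPermutations where

  open import Data.List using (List; []; _∷_; _++_; map; concatMap; cartesianProduct)
  open import Data.List.Membership.Propositional using (_∈_)
  open import Data.List.Membership.Propositional.Properties.WithK using (unique∧set⇒bag)
  open import Data.List.Relation.Unary.Unique.Propositional using (Unique)
  open import Data.List.Relation.Binary.Permutation.Propositional using (_↭_)
  open import Data.List.Relation.Binary.BagAndSetEquality using (∼bag⇒↭)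
  open import Data.Product using (_,_)
  open import Function.Bundles using (_⇔_)
  open import Relation.Binary.PropositionalEquality using (_≡_; refl; cong)

  concatMap-map≡cartesianProduct : ∀ {A B : Set} (xs : List A) (ys : List B) →
                                   concatMap (λ x → map (x ,_) ys) xs ≡ cartesianProduct xs ys
  concatMap-map≡cartesianProduct []       ys = refl
  concatMap-map≡cartesianProduct (x ∷ xs) ys = cong (map (x ,_) ys ++_) (concatMap-map≡cartesianProduct xs ys)

  sameMembers⇒↭ : ∀ {A : Set} {xs ys : List A} → Unique xs → Unique ys → (∀ {x} → x ∈ xs ⇔ x ∈ ys) → xs ↭ ys
  sameMembers⇒↭ !xs !ys xs⇔ys = ∼bag⇒↭ (unique∧set⇒bag !xs !ys xs⇔ys)

module FlipQuotient (n : ℕ) (X : Graph n) where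

  open PolynomialRing using (_≋_; polyRing)
  open LaplaceDeterminant polyRing
  open DefsDeterminant
  open ListPermutations
  open import Data.Integer using (ℤ; 0ℤ) renaming (_+_ to _+ℤ_; _*_ to _*ℤ_)
  import Data.Integer.Properties as ℤ
  open import Data.Integer.Tactic.RingSolver using (solve-∀)
  import Data.Nat.Properties as ℕ
  import Data.Fin as Fin
  import Data.Fin.Properties as Finₚ
  open import Data.Bool using (if_then_else_)
  open import Data.List using (List; []; _∷_; _++_; map; filter; allFin)
  open import Data.List.Membership.Propositional using (_∈_)
  open import Data.List.Membership.Propositional.Properties using (∈-filter⁺; ∈-filter⁻; ∈-cartesianProduct⁺; ∈-allFin; ∈-++⁺ˡ; ∈-++⁺ʳ; ∈-++⁻)
  open import Data.List.Membership.DecPropositional (pairEq {n}) using (_∈?_)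
  open import Data.List.Relation.Unary.All as All using (All; []; _∷_)
  import Data.List.Relation.Unary.All.Properties as All
  open import Data.List.Relation.Unary.Unique.Propositional using (Unique)
  import Data.List.Relation.Unary.Unique.Propositional.Properties as Unique
  open import Data.List.Relation.Binary.Pointwise using (Pointwise; []; _∷_)
  open import Data.List.Relation.Binary.Permutation.Propositional using (_↭_)
  open import Data.Product using (_,_; proj₁; proj₂)
  open import Data.Sum using (inj₁; inj₂)
  open import Function.Bundles using (_⇔_; mk⇔)
  import Data.List.Properties as List
  open import Function using (_∘_)
  open import Relation.Nullary using (¬_; Dec; yes; no; does; ¬?)
  open import Relation.Nullary.Decidable using (dec-true; dec-false)
  open import Relation.Unary using (Decidable)
  open import Relation.Binary.PropositionalEquality as ≡ using (_≡_; _≢_)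
  open CommutativeRing polyRing
    using (setoid; trans; reflexive; +-congˡ; +-comm; -‿cong; -‿inverseʳ; *-congʳ)
  open RingIdentities (CommutativeRing.ring polyRing) using (x-[y+z]≈x-y-z)
  open import Relation.Binary.Reasoning.Setoid setoid

  V : Set
  V = Pair n

  flip : V → V
  flip (i , j) = j , i

  T Q : Matrix
  T = charMat pairEq (boxAdj X)
  Q = charMat pairEq (quotMat X)

  Le Lt : V → Set
  Le v = proj₁ v Fin.≤ proj₂ v
  Lt v = proj₁ v Fin.< proj₂ v

  Le? : Decidable Le
  Le? v = proj₁ v Fin.≤? proj₂ v

  Lt? : Decidable Lt
  Lt? v = proj₁ v Fin.<? proj₂ v

  upper lower : List V
  upper = offDiagCells n
  lower = filter (λ v → ¬? (Le? v)) (allPairs n)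

  Lt⇒Le : ∀ {v} → Lt v → Le v
  Lt⇒Le = ℕ.<⇒≤

  Lt⇒¬Le-flip : ∀ {v} → Lt v → ¬ Le (flip v)
  Lt⇒¬Le-flip = ℕ.<⇒≱

  ¬Le⇒Lt-flip : ∀ {v} → ¬ Le v → Lt (flip v)
  ¬Le⇒Lt-flip = ℕ.≰⇒>

  Lt⇒offDiagonal : ∀ {v} → Lt v → proj₁ v ≢ proj₂ v
  Lt⇒offDiagonal = Finₚ.<⇒≢

  Le∧¬Lt⇒diagonal : ∀ {v} → Le v → ¬ Lt v → proj₁ v ≡ proj₂ v
  Le∧¬Lt⇒diagonal le ¬lt = Finₚ.≤-antisym le (ℕ.≮⇒≥ ¬lt)

  ∈-allPairs : ∀ v → v ∈ allPairs n
  ∈-allPairs (i , j) = ≡.subst ((i , j) ∈_) (≡.sym (concatMap-map≡cartesianProduct (allFin n) (allFin n)))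
                                (∈-cartesianProduct⁺ (∈-allFin i) (∈-allFin j))

  Unique-allPairs : Unique (allPairs n)
  Unique-allPairs = ≡.subst Unique (≡.sym (concatMap-map≡cartesianProduct (allFin n) (allFin n)))
                            (Unique.cartesianProduct⁺ (Unique.allFin⁺ n) (Unique.allFin⁺ n))

  module _ {P : V → Set} (P? : Decidable P) where

    selected⁺ : ∀ {v} → P v → v ∈ filter P? (allPairs n)
    selected⁺ {v} = ∈-filter⁺ P? (∈-allPairs v)

    selected⁻ : ∀ {v} → v ∈ filter P? (allPairs n) → P v
    selected⁻ v∈ = proj₂ (∈-filter⁻ P? {xs = allPairs n} v∈)

    Unique-selected : Unique (filter P? (allPairs n))
    Unique-selected = Unique.filter⁺ P? Unique-allPairs

  T-flip : ∀ u v → T (flip u) (flip v) ≡ T u v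
  T-flip (i , j) (k , l) = ≡.cong₂ (λ b a → (if b then tₚ else 0ₚ) -ₚ constₚ a) same-position same-adjacency
    where
    same-position : does (pairEq (j , i) (l , k)) ≡ does (pairEq (i , j) (k , l))
    same-position with pairEq (i , j) (k , l)
    ... | yes ij≡kl = dec-true (pairEq (j , i) (l , k)) (≡.cong flip ij≡kl)
    ... | no  ij≢kl = dec-false (pairEq (j , i) (l , k)) (λ ji≡lk → ij≢kl (≡.cong flip ji≡lk))
    swap-summands : ∀ a b c d → a *ℤ b +ℤ c *ℤ d ≡ d *ℤ c +ℤ b *ℤ a
    swap-summands = solve-∀
    same-adjacency : boxAdj X (j , i) (l , k) ≡ boxAdj X (i , j) (k , l)
    same-adjacency = swap-summands [ does (j Fin.≟ l) ] (adjMat X i k) (adjMat X j l) [ does (i Fin.≟ k) ]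

  addedColumns reduced : Matrix
  addedColumns = addColumns pairEq flip upper T
  reduced      = subRows pairEq flip lower addedColumns

  addedColumns-upper : ∀ u {v} → Lt v → addedColumns u v ≡ T u v +ₚ T u (flip v)
  addedColumns-upper u {v} lt rewrite dec-true (v ∈? upper) (selected⁺ Lt? lt) = ≡.refl

  addedColumns-diagonal : ∀ u {v} → ¬ Lt v → addedColumns u v ≡ T u v
  addedColumns-diagonal u {v} ¬lt rewrite dec-false (v ∈? upper) (¬lt ∘ selected⁻ Lt?) = ≡.refl

  reduced-upperRow : ∀ {u} v → Le u → reduced u v ≡ addedColumns u v
  reduced-upperRow {u} v le rewrite dec-false (u ∈? lower) (λ u∈ → selected⁻ (λ w → ¬? (Le? w)) u∈ le) = ≡.refl

  reduced-lowerRow : ∀ {u} v → ¬ Le u → reduced u v ≡ addedColumns u v -ₚ addedColumns (flip u) v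
  reduced-lowerRow {u} v ¬le rewrite dec-true (u ∈? lower) (selected⁺ (λ w → ¬? (Le? w)) ¬le) = ≡.refl

  -- Column (k , l) has absorbed column (l , k), just as quotMat sums over the cell {(k , l), (l , k)}.
  reduced-cell : ∀ u v → Le u → Le v → reduced u v ≋ Q u v
  reduced-cell u (k , l) le k≤l with Lt? (k , l)
  ... | yes k<l
    rewrite reduced-upperRow (k , l) le | addedColumns-upper u k<l
          | dec-false (pairEq u (l , k)) (λ u≡lk → Lt⇒¬Le-flip k<l (≡.subst Le u≡lk le))
          | dec-false (k Fin.≟ l) (Lt⇒offDiagonal k<l) = begin
      (δ -ₚ constₚ a) +ₚ (0ₚ -ₚ constₚ b)  ≈⟨ x-[y+z]≈x-y-z δ (constₚ a) (constₚ b) ⟨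
      δ -ₚ constₚ (a +ℤ b)                ≡⟨ ≡.cong (λ z → δ -ₚ constₚ (a +ℤ z)) (ℤ.+-identityʳ b) ⟨
      δ -ₚ constₚ (a +ℤ (b +ℤ 0ℤ))        ∎
    where
    δ : Poly
    δ = if does (pairEq u (k , l)) then tₚ else 0ₚ
    a b : ℤ
    a = boxAdj X u (k , l)
    b = boxAdj X u (l , k)
  ... | no ¬k<l with Le∧¬Lt⇒diagonal k≤l ¬k<l
  ...   | ≡.refl
    rewrite reduced-upperRow (k , k) le | addedColumns-diagonal u ¬k<l | dec-true (k Fin.≟ k) ≡.refl =
      reflexive (≡.cong (λ z → (if does (pairEq u (k , k)) then tₚ else 0ₚ) -ₚ constₚ z) (≡.sym (ℤ.+-identityʳ _)))

  -- Row u − row (flip u) vanishes on the cell columns because T is flip-invariant.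
  reduced-lower≈0 : ∀ u v → ¬ Le u → Le v → reduced u v ≋ 0ₚ
  reduced-lower≈0 u (k , l) ¬le k≤l with Lt? (k , l)
  ... | yes k<l
    rewrite reduced-lowerRow (k , l) ¬le | addedColumns-upper u k<l | addedColumns-upper (flip u) k<l
          | T-flip u (l , k) | T-flip u (k , l) =
      trans (+-congˡ (-‿cong (+-comm (T u (l , k)) (T u (k , l))))) (-‿inverseʳ (T u (k , l) +ₚ T u (l , k)))
  ... | no ¬k<l with Le∧¬Lt⇒diagonal k≤l ¬k<l
  ...   | ≡.refl
    rewrite reduced-lowerRow (k , k) ¬le | addedColumns-diagonal u ¬k<l | addedColumns-diagonal (flip u) ¬k<l
          | T-flip u (k , k) = -‿inverseʳ (T u (k , k))

  lowerMinor : Poly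
  lowerMinor = detOn reduced lower

  Unique-++lower : ∀ {W} → Unique W → (∀ {v} → v ∈ W → Le v) → Unique (W ++ lower)
  Unique-++lower !W W⊆Le = Unique.++⁺ !W (Unique-selected _) (λ (v∈W , v∈lower) → selected⁻ _ v∈lower (W⊆Le v∈W))

  -- After the column and row operations the matrix on W ++ lower is block triangular.
  detOn-factorises : ∀ W → Unique W → (∀ {v} → v ∈ W → Le v) → (∀ {v} → Lt v → v ∈ W) →
                     detOn T (W ++ lower) ≋ detOn Q W *ₚ lowerMinor
  detOn-factorises W !W W⊆Le Lt⊆W = begin
    detOn T (W ++ lower)
      ≈⟨ detOn-addColumns pairEq flip upper T (W ++ lower) (Unique-selected Lt?) !I upper-paired ⟨
    detOn addedColumns (W ++ lower)
      ≈⟨ detOn-subRows pairEq flip lower addedColumns (W ++ lower) (Unique-selected _) !I lower-paired ⟨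
    detRows (map reduced (W ++ lower)) (W ++ lower)
      ≡⟨ ≡.cong (λ fs → detRows fs (W ++ lower)) (List.map-++ reduced W lower) ⟩
    detRows (map reduced W ++ map reduced lower) (W ++ lower)
      ≈⟨ detRows-blockTriangular (map reduced W) (map reduced lower) W lower
           (ℕ.≤-reflexive (List.length-map reduced W)) lower-vanishes ⟩
    detRows (map reduced W) W *ₚ lowerMinor
      ≈⟨ *-congʳ (detRows-agreeOn Le W (All.tabulate W⊆Le) (cells-agree W (All.tabulate W⊆Le))) ⟩
    detOn Q W *ₚ lowerMinor ∎
    where
    !I : Unique (W ++ lower)
    !I = Unique-++lower !W W⊆Le

    upper-paired : PairedWithin pairEq flip upper (W ++ lower)
    upper-paired {s} s∈ = ∈-++⁺ˡ (Lt⊆W lt) , ∈-++⁺ʳ W (selected⁺ _ (Lt⇒¬Le-flip lt)) , λ fs∈ → ℕ.<-asym lt (selected⁻ Lt? fs∈)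
      where
      lt : Lt s
      lt = selected⁻ Lt? s∈

    lower-paired : PairedWithin pairEq flip lower (W ++ lower)
    lower-paired {s} s∈ = ∈-++⁺ʳ W s∈ , ∈-++⁺ˡ (Lt⊆W (¬Le⇒Lt-flip ¬le)) , λ fs∈ → selected⁻ _ fs∈ (Lt⇒Le (¬Le⇒Lt-flip ¬le))
      where
      ¬le : ¬ Le s
      ¬le = selected⁻ _ s∈

    lower-vanishes : VanishOn (map reduced lower) W
    lower-vanishes = All.map⁺ (All.tabulate λ u∈ → All.tabulate λ v∈ → reduced-lower≈0 _ _ (selected⁻ _ u∈) (W⊆Le v∈))

    cells-agree : ∀ W′ → All Le W′ → Pointwise (λ f g → ∀ v → Le v → f v ≋ g v) (map reduced W′) (map Q W′)
    cells-agree []       []          = []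
    cells-agree (u ∷ W′) (le ∷ les) = (λ v → reduced-cell u v le) ∷ cells-agree W′ les

  charPoly-X□X : charPoly pairEq (boxAdj X) (allPairs n) ≋ charPoly pairEq (quotMat X) (cells n) *ₚ lowerMinor
  charPoly-X□X = begin
    det T (allPairs n)            ≈⟨ det≋detOn T (allPairs n) ⟩
    detOn T (allPairs n)          ≈⟨ detOn-↭ T (sameMembers⇒↭ Unique-allPairs (Unique-++lower (Unique-selected Le?) (selected⁻ Le?)) members) ⟩
    detOn T (cells n ++ lower)    ≈⟨ detOn-factorises (cells n) (Unique-selected Le?) (selected⁻ Le?) (selected⁺ Le? ∘ Lt⇒Le) ⟩
    detOn Q (cells n) *ₚ lowerMinor ≈⟨ *-congʳ (det≋detOn Q (cells n)) ⟨
    det Q (cells n) *ₚ lowerMinor ∎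
    where
    members : ∀ {v} → v ∈ allPairs n ⇔ v ∈ cells n ++ lower
    members {v} = mk⇔ (λ _ → split (Le? v)) (λ _ → ∈-allPairs v)
      where
      split : Dec (Le v) → v ∈ cells n ++ lower
      split (yes le) = ∈-++⁺ˡ (selected⁺ Le? le)
      split (no ¬le) = ∈-++⁺ʳ (cells n) (selected⁺ _ ¬le)

  charPoly-X□X∖D : charPoly pairEq (boxAdj X) (offDiagPairs n) ≋ charPoly pairEq (quotMat X) (offDiagCells n) *ₚ lowerMinor
  charPoly-X□X∖D = begin
    det T (offDiagPairs n)        ≈⟨ det≋detOn T (offDiagPairs n) ⟩
    detOn T (offDiagPairs n)      ≈⟨ detOn-↭ T (sameMembers⇒↭ (Unique-selected _) (Unique-++lower (Unique-selected Lt?) (Lt⇒Le ∘ selected⁻ Lt?)) members) ⟩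
    detOn T (upper ++ lower)      ≈⟨ detOn-factorises upper (Unique-selected Lt?) (Lt⇒Le ∘ selected⁻ Lt?) (selected⁺ Lt?) ⟩
    detOn Q upper *ₚ lowerMinor   ≈⟨ *-congʳ (det≋detOn Q upper) ⟨
    det Q upper *ₚ lowerMinor     ∎
    where
    members : ∀ {v} → v ∈ offDiagPairs n ⇔ v ∈ upper ++ lower
    members {v} = mk⇔ to from
      where
      to : v ∈ offDiagPairs n → v ∈ upper ++ lower
      to v∈ with Le? v
      ... | no ¬le = ∈-++⁺ʳ upper (selected⁺ _ ¬le)
      ... | yes le = ∈-++⁺ˡ (selected⁺ Lt? (Finₚ.≤∧≢⇒< le (selected⁻ _ v∈)))
      from : v ∈ upper ++ lower → v ∈ offDiagPairs n
      from v∈ with ∈-++⁻ upper v∈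
      ... | inj₁ v∈upper = selected⁺ _ (Lt⇒offDiagonal (selected⁻ Lt? v∈upper))
      ... | inj₂ v∈lower = selected⁺ _ λ i≡j → selected⁻ _ v∈lower (Finₚ.≤-reflexive i≡j)

mainTheorem5 : (n : ℕ) (X : Graph n) →
    charPoly pairEq (quotMat X) (offDiagCells n) *ₚ charPoly pairEq (boxAdj X) (allPairs n)
    ≈ₚ charPoly pairEq (boxAdj X) (offDiagPairs n) *ₚ charPoly pairEq (quotMat X) (cells n)
mainTheorem5 n X = ≋⇒≈ₚ (begin
  φ[Y∖D] *ₚ φ[X□X]                ≈⟨ *-congˡ {φ[Y∖D]} charPoly-X□X ⟩
  φ[Y∖D] *ₚ (φ[Y] *ₚ lowerMinor)  ≈⟨ x∙yz≈xz∙y φ[Y∖D] φ[Y] lowerMinor ⟩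
  (φ[Y∖D] *ₚ lowerMinor) *ₚ φ[Y]  ≈⟨ *-congʳ charPoly-X□X∖D ⟨
  φ[X□X∖D] *ₚ φ[Y]                ∎)
  where
  open PolynomialRing using (≋⇒≈ₚ; polyRing)
  open FlipQuotient n X using (charPoly-X□X; charPoly-X□X∖D; lowerMinor)
  open CommutativeRing polyRing using (setoid; *-congˡ; *-congʳ; *-commutativeSemigroup)
  open import Algebra.Properties.CommutativeSemigroup *-commutativeSemigroup using (x∙yz≈xz∙y)
  open import Relation.Binary.Reasoning.Setoid setoid
  φ[X□X] φ[X□X∖D] φ[Y] φ[Y∖D] : Poly
  φ[X□X] = charPoly pairEq (boxAdj X) (allPairs n)
  φ[X□X∖D] = charPoly pairEq (boxAdj X) (offDiagPairs n)
  φ[Y] = charPoly pairEq (quotMat X) (cells n)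
  φ[Y∖D] = charPoly pairEq (quotMat X) (offDiagCells n)
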